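{- Let $T$ be a tree of order $n$. Then $\mathrm{conv}^{\leq 4}(T) \leq \left\lceil \frac{3(n-1)}{8}\right\rceil$.
   Context: In an oriented graph, the inversion of a vertex set $X$ reverses the orientation of every arc with both endvertices in $X$; a $(\leq p)$-inversion is the inversion of a set of at most $p$ vertices. For a graph $G$, $\mathrm{conv}^{\leq p}(G)$ is the minimum number of $(\leq p)$-inversions transforming an orientation of $G$ into its converse (all arcs reversed); this does not depend on the chosen orientation. -}

module Defs where

open import Data.Nat using (ℕ; zero; suc; _+_; _*_; _∸_; _≤_)
open import Data.Bool using (Bool; true; false; _∧_; _∨_; if_then_else_)
open import Data.Fin using (Fin)
open import Data.Fin.Subset using (Subset; ∣_∣)
open import Data.Vec using (lookup)
open import Data.List using (List; []; _∷_; _++_; [_]; length; foldr)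
open import Data.List.Relation.Unary.All using (All)
open import Data.List.Relation.Unary.Unique.Propositional using (Unique)
open import Data.Product using (Σ; _×_)
open import Data.Unit using (⊤)
open import Relation.Nullary using (¬_)
open import Relation.Binary.PropositionalEquality using (_≡_)

record Graph (n : ℕ) : Set where
  field
    adj   : Fin n → Fin n → Bool
    sym   : ∀ u v → adj u v ≡ adj v u
    irrefl : ∀ u → adj u u ≡ false
open Graph public

data Walk {n : ℕ} (G : Graph n) : Fin n → Fin n → Set where
  here : ∀ {u} → Walk G u u
  step : ∀ {u w v} → adj G u w ≡ true → Walk G w v → Walk G u v

Connected : ∀ {n} → Graph n → Set
Connected G = ∀ u v → Walk G u v

ConsecAdj : ∀ {n} → Graph n → List (Fin n) → Set
ConsecAdj G [] = ⊤
ConsecAdj G (x ∷ []) = ⊤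
ConsecAdj G (x ∷ y ∷ r) = (adj G x y ≡ true) × ConsecAdj G (y ∷ r)

HasCycle : ∀ {n} → Graph n → Set
HasCycle {n} G = Σ (Fin n) λ x → Σ (List (Fin n)) λ ys →
  (2 ≤ length ys) × Unique (x ∷ ys) × ConsecAdj G (x ∷ ys ++ [ x ])

IsTree : ∀ {n} → Graph n → Set
IsTree G = Connected G × ¬ HasCycle G

record Orientation {n : ℕ} (G : Graph n) : Set where
  field
    arc      : Fin n → Fin n → Bool
    covers   : ∀ u v → arc u v ∨ arc v u ≡ adj G u v
    antisym  : ∀ u v → arc u v ∧ arc v u ≡ false
open Orientation public

Arcs : ℕ → Set
Arcs n = Fin n → Fin n → Bool

invert : ∀ {n} → Subset n → Arcs n → Arcs n
invert X a u v = if lookup X u ∧ lookup X v then a v u else a u v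

invertAll : ∀ {n} → List (Subset n) → Arcs n → Arcs n
invertAll [] a = a
invertAll (X ∷ Xs) a = invertAll Xs (invert X a)

converse : ∀ {n} → Arcs n → Arcs n
converse a u v = a v u

-- Since the value of
-- conv^{≤p} does not depend on the orientation, we require this for every orientation.
ConvAtMost : ∀ {n} → ℕ → Graph n → ℕ → Set
ConvAtMost {n} p G k = (D : Orientation G) →
  Σ (List (Subset n)) λ Xs →
    (length Xs ≤ k) × All (λ X → ∣ X ∣ ≤ p) Xs ×
    (∀ u v → invertAll Xs (arc D) u v ≡ converse (arc D) u v)

-- Only edges carry arcs, so a family of vertex sets turns an orientation of T into its converse as soon
-- as every edge lies inside an odd number of the sets. Root T at a leaf r, so that every other vertex x
-- names its parent edge x – par x, and cover the edges greedily from the leaves up by 4-vertex sets of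
-- two kinds: subtrees with three edges (paths and claws), and pairs of single edges, floats, lying
-- below different children of a vertex, which induce just these two edges. Charging 3 units to every
-- edge and 8 to every set, each subtree pays for its own sets and still hands a few open edges (and at
-- most one float, at one extra unit) up to its parent; closing the last open edges through the leaf
-- root costs at most 7 more units, so that 8 · #sets ≤ 3 (n − 1) + 7.

module Submission where

open import Defs hiding (sym)

open import Data.Bool using (Bool; true; false; not; _∧_; _∨_; _xor_; if_then_else_)
open import Data.Bool.Properties
  using (∨-zeroʳ; ∨-identityʳ; ∨-assoc; ∧-comm; xor-same; xor-identityʳ; xor-assoc; xor-comm; if-xor; if-cong; if-eta)
  renaming (_≟_ to _≟ᵇ_)
import Data.Bool.Solver
open import Data.Empty using (⊥)
open import Data.Fin using (Fin; zero; suc)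
open import Data.Fin.Properties using (_≟_; any?)
open import Data.Fin.Subset using (Subset; ∣_∣; ⁅_⁆; _∪_) renaming (⊥ to ∅)
open import Data.Fin.Subset.Properties using (∣⁅x⁆∣≡1; ∣⊥∣≡0; ∣p∣≤n; ∪-identityˡ)
open import Data.List using (List; []; _∷_; _++_; [_]; length; map; foldr; filter; allFin)
open import Data.List.Extrema.Nat using (argmax; v≤f[argmax]⁺)
open import Data.List.Membership.Propositional using (_∈_)
open import Data.List.Membership.Propositional.Properties using (∈-filter⁺; ∈-allFin)
open import Data.List.Properties using (length-++; length-tabulate; length-map)
open import Data.List.Relation.Unary.All as All using (All; []; _∷_)
import Data.List.Relation.Unary.All.Properties as All
open import Data.List.Relation.Unary.All.Properties using (++⁺; all-filter)
open import Data.List.Relation.Unary.AllPairs as AllPairs using ([]; _∷_)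
open import Data.List.Relation.Unary.Any as Any using (here; there)
open import Data.List.Relation.Unary.Unique.Propositional using (Unique)
import Data.List.Relation.Unary.Unique.Propositional.Properties as Unique
open import Data.List.Relation.Unary.Unique.Propositional.Properties using (allFin⁺)
open import Data.Nat using (ℕ; zero; suc; _+_; _*_; _∸_; _≤_; _<_; z≤n; s≤s)
open import Data.Nat.DivMod using (_/_; m*n/n≡m; /-monoˡ-≤)
open import Data.Nat.Properties
  using ( ≤-refl; ≤-reflexive; ≤-trans; ≤-antisym; ≤-pred; _≤?_; <-irrefl; <-asym; <-trans; <-≤-trans; ≤-<-trans
        ; <⇒≤; <⇒≢; <⇒≱; ≤⇒≯; ≰⇒>; ≤∧≢⇒<; n≤0⇒n≡0; n≤1+n; m≤n⇒m≤1+n; m<n⇒m<1+n; m≤m+n; m≤n+m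
        ; suc-injective; 1+n≢n; +-comm; +-assoc; +-suc; +-identityʳ; *-comm; *-suc; *-distribˡ-+; m+n∸n≡m
        ; +-mono-≤; +-monoˡ-≤; +-monoʳ-≤; +-monoʳ-<; *-monoʳ-≤; ∸-monoˡ-≤; module ≤-Reasoning )
open import Data.Nat.Solver using (module +-*-Solver)
open import Data.Product using (Σ; _×_; _,_; proj₁; proj₂)
open import Data.Sum using (_⊎_; inj₁; inj₂)
open import Data.Unit using (⊤; tt)
open import Data.Vec using (lookup; []; _∷_)
open import Data.Vec.Properties using (lookup-zipWith; lookup-replicate)
open import Function using (id)
open import Relation.Binary.PropositionalEquality
  using (_≡_; _≢_; ≢-sym; refl; sym; trans; cong; cong₂; subst; module ≡-Reasoning)
open import Relation.Nullary using (¬_; Dec; does; yes; no; contradiction)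
open import Relation.Nullary.Decidable using (¬?; dec-true; dec-false; _×-dec_)

open +-*-Solver using (_:+_; _:*_; _:=_) renaming (solve to ℕ-solve; con to ℕ-con)
open Data.Bool.Solver.xor-∧-Solver using () renaming (solve to xor-solve; _:+_ to _⊕_; _:=_ to _≋_; con to lit)

private variable
  n : ℕ
  A : Set

≤-slack : ∀ {a b} k → a + k ≡ b → a ≤ b
≤-slack {a} k a+k≡b = subst (a ≤_) a+k≡b (m≤m+n a k)

xor-move : ∀ {x e y} → x xor e ≡ y → x ≡ y xor e
xor-move {x} {e} refl = sym (trans (xor-assoc x e e) (trans (cong (x xor_) (xor-same e)) (xor-identityʳ x)))

-- Parity of coverings

infix 7 _==_ _∈ᵇ_

_==_ : Fin n → Fin n → Bool
x == y = does (x ≟ y)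

==-refl : (x : Fin n) → (x == x) ≡ true
==-refl x = dec-true (x ≟ x) refl

==-false : {x y : Fin n} → x ≢ y → (x == y) ≡ false
==-false {x = x} {y} = dec-false (x ≟ y)

==-sound : {x y : Fin n} → (x == y) ≡ true → x ≡ y
==-sound {x = x} {y} e with x ≟ y | e
... | yes x≡y | _ = x≡y
... | no _    | ()

_∈ᵇ_ : Fin n → List (Fin n) → Bool
x ∈ᵇ []       = false
x ∈ᵇ (y ∷ ys) = x == y ∨ x ∈ᵇ ys

∈ᵇ-++ : (x : Fin n) (xs ys : List (Fin n)) → x ∈ᵇ (xs ++ ys) ≡ (x ∈ᵇ xs ∨ x ∈ᵇ ys)
∈ᵇ-++ x []       ys = refl
∈ᵇ-++ x (y ∷ xs) ys = trans (cong (x == y ∨_) (∈ᵇ-++ x xs ys)) (sym (∨-assoc (x == y) _ _))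

∈⇒∈ᵇ : {x : Fin n} {xs : List (Fin n)} → x ∈ xs → x ∈ᵇ xs ≡ true
∈⇒∈ᵇ {x = x} {_ ∷ xs} (here refl) = cong (_∨ x ∈ᵇ xs) (==-refl x)
∈⇒∈ᵇ {x = x} {y ∷ _} (there x∈xs) = trans (cong (x == y ∨_) (∈⇒∈ᵇ x∈xs)) (∨-zeroʳ (x == y))

∉⇒∈ᵇ : {x : Fin n} (xs : List (Fin n)) → All (x ≢_) xs → x ∈ᵇ xs ≡ false
∉⇒∈ᵇ []       []             = refl
∉⇒∈ᵇ (y ∷ xs) (x≢y ∷ x∉xs) rewrite ==-false x≢y = ∉⇒∈ᵇ xs x∉xs

∈ᵇ⇒All : {P : Fin n → Set} (xs : List (Fin n)) → All P xs → ∀ y → y ∈ᵇ xs ≡ true → P y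
∈ᵇ⇒All (z ∷ xs) (pz ∷ pxs) y y∈ with y ≟ z
... | yes refl = pz
... | no _     = ∈ᵇ⇒All xs pxs y y∈

parity : List (Fin n) → Fin n → Bool
parity []       x = false
parity (y ∷ ys) x = (x == y) xor parity ys x

parity-++ : (xs ys : List (Fin n)) (x : Fin n) → parity (xs ++ ys) x ≡ parity xs x xor parity ys x
parity-++ []       ys x = refl
parity-++ (y ∷ xs) ys x =
  trans (cong ((x == y) xor_) (parity-++ xs ys x)) (sym (xor-assoc (x == y) (parity xs x) (parity ys x)))

parity-Unique : (xs : List (Fin n)) → Unique xs → ∀ x → parity xs x ≡ x ∈ᵇ xs
parity-Unique []       _              x = refl
parity-Unique (y ∷ xs) (y∉xs ∷ uxs) x with x ≟ y
... | yes refl = cong not (trans (parity-Unique xs uxs x) (∉⇒∈ᵇ xs y∉xs))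
... | no _     = parity-Unique xs uxs x

coverParity : List (List (Fin n)) → Fin n → Fin n → Bool
coverParity []       u v = false
coverParity (X ∷ Xs) u v = (u ∈ᵇ X ∧ v ∈ᵇ X) xor coverParity Xs u v

coverParity-++ : (Xs Ys : List (List (Fin n))) (u v : Fin n) →
  coverParity (Xs ++ Ys) u v ≡ coverParity Xs u v xor coverParity Ys u v
coverParity-++ []       Ys u v = refl
coverParity-++ (X ∷ Xs) Ys u v =
  trans (cong ((u ∈ᵇ X ∧ v ∈ᵇ X) xor_) (coverParity-++ Xs Ys u v))
        (sym (xor-assoc (u ∈ᵇ X ∧ v ∈ᵇ X) (coverParity Xs u v) (coverParity Ys u v)))

coverParity-sym : (Xs : List (List (Fin n))) (u v : Fin n) → coverParity Xs u v ≡ coverParity Xs v u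
coverParity-sym []       u v = refl
coverParity-sym (X ∷ Xs) u v = cong₂ _xor_ (∧-comm (u ∈ᵇ X) (v ∈ᵇ X)) (coverParity-sym Xs u v)

toSubset : List (Fin n) → Subset n
toSubset = foldr (λ x s → ⁅ x ⁆ ∪ s) ∅

lookup-⁅⁆ : (x y : Fin n) → lookup ⁅ y ⁆ x ≡ (x == y)
lookup-⁅⁆ zero    zero    = refl
lookup-⁅⁆ zero    (suc y) = refl
lookup-⁅⁆ (suc x) zero    = lookup-replicate x false
lookup-⁅⁆ (suc x) (suc y) = lookup-⁅⁆ x y

lookup-toSubset : (X : List (Fin n)) (x : Fin n) → lookup (toSubset X) x ≡ (x ∈ᵇ X)
lookup-toSubset []      x = lookup-replicate x false
lookup-toSubset (y ∷ X) x =
  trans (lookup-zipWith _∨_ x ⁅ y ⁆ (toSubset X)) (cong₂ _∨_ (lookup-⁅⁆ x y) (lookup-toSubset X x))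

∣p∪q∣≤∣p∣+∣q∣ : (p q : Subset n) → ∣ p ∪ q ∣ ≤ ∣ p ∣ + ∣ q ∣
∣p∪q∣≤∣p∣+∣q∣ []          []          = z≤n
∣p∪q∣≤∣p∣+∣q∣ (true ∷ p)  (true ∷ q)  =
  s≤s (≤-trans (∣p∪q∣≤∣p∣+∣q∣ p q) (+-monoʳ-≤ ∣ p ∣ (n≤1+n ∣ q ∣)))
∣p∪q∣≤∣p∣+∣q∣ (true ∷ p)  (false ∷ q) = s≤s (∣p∪q∣≤∣p∣+∣q∣ p q)
∣p∪q∣≤∣p∣+∣q∣ (false ∷ p) (true ∷ q)  =
  ≤-trans (s≤s (∣p∪q∣≤∣p∣+∣q∣ p q)) (≤-reflexive (sym (+-suc ∣ p ∣ ∣ q ∣)))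
∣p∪q∣≤∣p∣+∣q∣ (false ∷ p) (false ∷ q) = ∣p∪q∣≤∣p∣+∣q∣ p q

∣toSubset∣≤length : (X : List (Fin n)) → ∣ toSubset X ∣ ≤ length X
∣toSubset∣≤length {n} []      = ≤-reflexive (∣⊥∣≡0 n)
∣toSubset∣≤length     (x ∷ X) =
  ≤-trans (∣p∪q∣≤∣p∣+∣q∣ ⁅ x ⁆ (toSubset X)) (+-mono-≤ (≤-reflexive (∣⁅x⁆∣≡1 x)) (∣toSubset∣≤length X))

invertAll-coverParity : (Xs : List (List (Fin n))) (a : Arcs n) (u v : Fin n) →
  invertAll (map toSubset Xs) a u v ≡ (if coverParity Xs u v then a v u else a u v)
invertAll-coverParity []       a u v = refl
invertAll-coverParity (X ∷ Xs) a u v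
  rewrite invertAll-coverParity Xs (invert (toSubset X) a) u v
        | lookup-toSubset X u | lookup-toSubset X v | ∧-comm (v ∈ᵇ X) (u ∈ᵇ X)
  = trans (sym (if-xor (coverParity Xs u v))) (if-cong (xor-comm (coverParity Xs u v) (u ∈ᵇ X ∧ v ∈ᵇ X)))

-- Non-edges carry no arc in either direction, so only the edges need to be covered.
invertAll-converse : {G : Graph n} (D : Orientation G) (Xs : List (List (Fin n))) →
  (∀ u v → adj G u v ≡ true → coverParity Xs u v ≡ true) →
  ∀ u v → invertAll (map toSubset Xs) (arc D) u v ≡ converse (arc D) u v
invertAll-converse {G = G} D Xs covered u v rewrite invertAll-coverParity Xs (arc D) u v with adj G u v in uv
... | true  rewrite covered u v uv = refl
... | false with arc D u v | arc D v u | trans (covers D u v) uv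
...   | false | false | _  = if-eta (coverParity Xs u v)

-- Rooted trees

record Rooted (n : ℕ) (r : Fin n) : Set where
  field
    par     : Fin n → Fin n
    dep     : Fin n → ℕ
    par-r   : par r ≡ r
    dep-r   : dep r ≡ 0
    dep-par : ∀ x → x ≢ r → suc (dep (par x)) ≡ dep x
    dep<n   : ∀ x → dep x < n

module RootedTheory {n : ℕ} {r : Fin n} (R : Rooted n r) where
  open Rooted R

  IsChild : Fin n → Fin n → Set
  IsChild p c = par c ≡ p × c ≢ r

  dep-child : ∀ {p c} → IsChild p c → dep c ≡ suc (dep p)
  dep-child (refl , c≢r) = sym (dep-par _ c≢r)

  dep-par-< : ∀ x → x ≢ r → dep (par x) < dep x
  dep-par-< x x≢r = ≤-reflexive (dep-par x x≢r)

  child-< : ∀ {p c} → IsChild p c → dep p < dep c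
  child-< (refl , c≢r) = dep-par-< _ c≢r

  dep≡0⇒root : ∀ x → dep x ≡ 0 → x ≡ r
  dep≡0⇒root x d≡0 with x ≟ r
  ... | yes x≡r = x≡r
  ... | no x≢r with () ← trans (dep-par x x≢r) d≡0

  dep-<⇒≢ : ∀ {x y} → dep x < dep y → x ≢ y
  dep-<⇒≢ d< refl = <-irrefl refl d<

  dep->⇒≢ : ∀ {x y} → dep y < dep x → x ≢ y
  dep->⇒≢ d> refl = <-irrefl refl d>

  par≢ : ∀ x → x ≢ r → par x ≢ x
  par≢ x x≢r = dep-<⇒≢ (dep-par-< x x≢r)

  dep-pos⇒≢r : ∀ {x} → 0 < dep x → x ≢ r
  dep-pos⇒≢r {x} 0<d refl = <-irrefl (sym dep-r) 0<d

  infix 4 _≼_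
  data _≼_ : Fin n → Fin n → Set where
    here : ∀ {x} → x ≼ x
    up   : ∀ {x y} → x ≢ r → par x ≼ y → x ≼ y

  ≼-dep : ∀ {x y} → x ≼ y → dep y ≤ dep x
  ≼-dep here        = ≤-refl
  ≼-dep (up x≢r x≼y) = ≤-trans (≼-dep x≼y) (<⇒≤ (dep-par-< _ x≢r))

  ≼-dep-≡ : ∀ {x y} → x ≼ y → dep y ≡ dep x → y ≡ x
  ≼-dep-≡ here         _ = refl
  ≼-dep-≡ (up x≢r x≼y) e = contradiction e (<⇒≢ (≤-<-trans (≼-dep x≼y) (dep-par-< _ x≢r)))

  ≼-dep-< : ∀ {x y} → x ≼ y → y ≢ x → dep y < dep x
  ≼-dep-< x≼y y≢x = ≤∧≢⇒< (≼-dep x≼y) (λ e → y≢x (≼-dep-≡ x≼y e))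

  ≼-par : ∀ {x y} → x ≼ y → y ≢ x → par x ≼ y
  ≼-par here         y≢x = contradiction refl y≢x
  ≼-par (up _ px≼y) _   = px≼y

  ≼-one-up : ∀ {x y} → x ≼ y → suc (dep y) ≡ dep x → y ≡ par x
  ≼-one-up {x} {y} x≼y e with x ≟ r
  ... | yes refl = contradiction (trans e dep-r) λ ()
  ... | no x≢r = ≼-dep-≡ (≼-par x≼y y≢x) (suc-injective (trans e (sym (dep-par x x≢r))))
    where
    y≢x : y ≢ x
    y≢x refl = 1+n≢n e

  ≼-trans-par : ∀ {x y} → x ≼ y → y ≢ r → x ≼ par y
  ≼-trans-par here         y≢r = up y≢r here
  ≼-trans-par (up x≢r x≼y) y≢r = up x≢r (≼-trans-par x≼y y≢r)

  child-≼ : ∀ {p c} → IsChild p c → c ≼ p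
  child-≼ (refl , c≢r) = up c≢r here

  ≼-child : ∀ {x p c} → x ≼ c → IsChild p c → x ≼ p
  ≼-child x≼c (refl , c≢r) = ≼-trans-par x≼c c≢r

  ≼-unique : ∀ {x v w} → x ≼ v → x ≼ w → dep v ≡ dep w → v ≡ w
  ≼-unique here         x≼w          e = sym (≼-dep-≡ x≼w (sym e))
  ≼-unique (up x≢r x≼v) here         e = ≼-dep-≡ (up x≢r x≼v) e
  ≼-unique (up _ x≼v)   (up _ x≼w)   e = ≼-unique x≼v x≼w e

  ≼-siblings : ∀ {p x y o o′} → x ≼ o → y ≼ o′ → IsChild p o → IsChild p o′ → o ≢ o′ → x ≢ y
  ≼-siblings x≼o y≼o′ ko ko′ o≢o′ refl = o≢o′ (≼-unique x≼o y≼o′ (trans (dep-child ko) (sym (dep-child ko′))))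

  ≼-root′ : ∀ k x → dep x ≤ k → x ≼ r
  ≼-root′ k x d≤k with x ≟ r
  ... | yes refl = here
  ≼-root′ zero    x d≤k | no x≢r = contradiction (dep≡0⇒root x (n≤0⇒n≡0 d≤k)) x≢r
  ≼-root′ (suc k) x d≤k | no x≢r = up x≢r (≼-root′ k (par x) (≤-pred (≤-trans (dep-par-< x x≢r) d≤k)))

  ≼-root : ∀ x → x ≼ r
  ≼-root x = ≼-root′ (dep x) x ≤-refl

  ≼-dec′ : ∀ k x y → dep x ≤ k → Dec (x ≼ y)
  ≼-dec′ k x y d≤k with x ≟ y
  ... | yes refl = yes here
  ... | no x≢y with x ≟ r
  ...   | yes refl = no λ { here → x≢y refl ; (up r≢r _) → r≢r refl }
  ≼-dec′ zero    x y d≤k | no x≢y | no x≢r = contradiction (dep≡0⇒root x (n≤0⇒n≡0 d≤k)) x≢r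
  ≼-dec′ (suc k) x y d≤k | no x≢y | no x≢r with ≼-dec′ k (par x) y (≤-pred (≤-trans (dep-par-< x x≢r) d≤k))
  ... | yes px≼y = yes (up x≢r px≼y)
  ... | no px⋠y  = no λ { here → x≢y refl ; (up _ px≼y) → px⋠y px≼y }

  _≼?_ : ∀ x y → Dec (x ≼ y)
  x ≼? y = ≼-dec′ (dep x) x y ≤-refl

  ≼-child-of : ∀ {x p} → x ≼ p → x ≢ p → Σ (Fin n) λ c → IsChild p c × x ≼ c
  ≼-child-of here          x≢p = contradiction refl x≢p
  ≼-child-of {x} {p} (up x≢r px≼p) x≢p with par x ≟ p
  ... | yes px≡p = x , (px≡p , x≢r) , here
  ... | no px≢p with ≼-child-of px≼p px≢p
  ...   | c , kc , px≼c = c , kc , up x≢r px≼c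

ParentEdges : {r : Fin n} → Graph n → Rooted n r → Set
ParentEdges {n} {r} T R = ∀ x → x ≢ r → adj T x (Rooted.par R x) ≡ true

∣⁅x⁆∪p∣≡1+∣p∣ : (x : Fin n) (p : Subset n) → lookup p x ≡ false → ∣ ⁅ x ⁆ ∪ p ∣ ≡ suc ∣ p ∣
∣⁅x⁆∪p∣≡1+∣p∣ zero    (false ∷ p) _  = cong suc (cong ∣_∣ (∪-identityˡ p))
∣⁅x⁆∪p∣≡1+∣p∣ (suc x) (true  ∷ p) px = cong suc (∣⁅x⁆∪p∣≡1+∣p∣ x p px)
∣⁅x⁆∪p∣≡1+∣p∣ (suc x) (false ∷ p) px = ∣⁅x⁆∪p∣≡1+∣p∣ x p px

module SpanningTree (T : Graph n) (r : Fin n) where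

  record Growing : Set where
    constructor growing
    field
      vis : Subset n
      par : Fin n → Fin n
      dep : Fin n → ℕ
  open Growing

  Visited : Growing → Fin n → Set
  Visited g x = lookup (vis g) x ≡ true

  record Invariant (g : Growing) : Set where
    field
      r-vis     : Visited g r
      par-r     : par g r ≡ r
      dep-r     : dep g r ≡ 0
      par-vis   : ∀ x → Visited g x → x ≢ r → Visited g (par g x)
      par-adj   : ∀ x → Visited g x → x ≢ r → adj T x (par g x) ≡ true
      dep-par   : ∀ x → Visited g x → x ≢ r → suc (dep g (par g x)) ≡ dep g x
      dep<∣vis∣ : ∀ x → Visited g x → dep g x < ∣ vis g ∣
  open Invariant

  Closed : Growing → Set
  Closed g = ∀ u w → Visited g u → adj T u w ≡ true → Visited g w

  start : Growing
  start = growing ⁅ r ⁆ (λ _ → r) (λ _ → 0)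

  start-invariant : Invariant start
  start-invariant = record
    { r-vis     = trans (lookup-⁅⁆ r r) (==-refl r)
    ; par-r     = refl
    ; dep-r     = refl
    ; par-vis   = λ x vx x≢r → contradiction (==-sound (trans (sym (lookup-⁅⁆ x r)) vx)) x≢r
    ; par-adj   = λ x vx x≢r → contradiction (==-sound (trans (sym (lookup-⁅⁆ x r)) vx)) x≢r
    ; dep-par   = λ x vx x≢r → contradiction (==-sound (trans (sym (lookup-⁅⁆ x r)) vx)) x≢r
    ; dep<∣vis∣ = λ x _ → subst (0 <_) (sym (∣⁅x⁆∣≡1 r)) (s≤s z≤n)
    }

  attach : Growing → Fin n → Fin n → Growing
  attach g u w = growing (⁅ w ⁆ ∪ vis g) (λ y → if y == w then u else par g y)
                         (λ y → if y == w then suc (dep g u) else dep g y)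

  lookup-attach : ∀ g u w y → lookup (vis (attach g u w)) y ≡ (y == w ∨ lookup (vis g) y)
  lookup-attach g u w y = trans (lookup-zipWith _∨_ y ⁅ w ⁆ (vis g)) (cong (_∨ lookup (vis g) y) (lookup-⁅⁆ y w))

  attach-invariant : ∀ g u w → Invariant g → Visited g u → lookup (vis g) w ≡ false → adj T u w ≡ true →
                     Invariant (attach g u w)
  attach-invariant g u w I vu vw uw = record
    { r-vis     = still-visited r (r-vis I)
    ; par-r     = trans (if-cong (==-false r≢w)) (par-r I)
    ; dep-r     = trans (if-cong (==-false r≢w)) (dep-r I)
    ; par-vis   = λ x vx x≢r → proj₁ (parent-ok x vx x≢r)
    ; par-adj   = λ x vx x≢r → proj₁ (proj₂ (parent-ok x vx x≢r))
    ; dep-par   = λ x vx x≢r → proj₂ (proj₂ (parent-ok x vx x≢r))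
    ; dep<∣vis∣ = depth-bound
    }
    where
    g′ = attach g u w

    visited≢w : ∀ {y} → Visited g y → y ≢ w
    visited≢w vy refl = contradiction (trans (sym vy) vw) λ ()

    r≢w : r ≢ w
    r≢w = visited≢w (r-vis I)

    still-visited : ∀ y → Visited g y → Visited g′ y
    still-visited y vy = trans (lookup-attach g u w y) (trans (cong (y == w ∨_) vy) (∨-zeroʳ (y == w)))

    ∣vis′∣ : ∣ vis g′ ∣ ≡ suc ∣ vis g ∣
    ∣vis′∣ = ∣⁅x⁆∪p∣≡1+∣p∣ w (vis g) vw

    old : ∀ {y} → (y == w) ≡ false → Visited g′ y → Visited g y
    old y≢w vy = trans (sym (cong (_∨ _) y≢w)) (trans (sym (lookup-attach g u w _)) vy)

    parent-ok : ∀ x → Visited g′ x → x ≢ r →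
                Visited g′ (par g′ x) × adj T x (par g′ x) ≡ true × suc (dep g′ (par g′ x)) ≡ dep g′ x
    parent-ok x vx x≢r with x ≟ w
    ... | yes refl = still-visited u vu , trans (Graph.sym T x u) uw
                   , cong suc (if-cong (==-false (visited≢w vu)))
    ... | no x≢w =
      let vx = old (==-false x≢w) vx
          vp = par-vis I x vx x≢r
      in  still-visited _ vp , par-adj I x vx x≢r
        , trans (cong suc (if-cong (==-false (visited≢w vp)))) (dep-par I x vx x≢r)

    depth-bound : ∀ x → Visited g′ x → dep g′ x < ∣ vis g′ ∣
    depth-bound x vx rewrite ∣vis′∣ with x ≟ w
    ... | yes refl = s≤s (dep<∣vis∣ I u vu)
    ... | no x≢w = m<n⇒m<1+n (dep<∣vis∣ I x (old (==-false x≢w) vx))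

  Frontier : Growing → Set
  Frontier g = Σ (Fin n) λ u → Σ (Fin n) λ w → Visited g u × lookup (vis g) w ≡ false × adj T u w ≡ true

  frontier? : ∀ g → Dec (Frontier g)
  frontier? g = any? λ u → any? λ w → (lookup (vis g) u ≟ᵇ true) ×-dec (lookup (vis g) w ≟ᵇ false) ×-dec (adj T u w ≟ᵇ true)

  grow : (k : ℕ) (g : Growing) → Invariant g → n < ∣ vis g ∣ + k → Σ Growing λ g′ → Invariant g′ × Closed g′
  grow zero    g I n<k = contradiction (≤-trans n<k (≤-reflexive (+-identityʳ _))) (≤⇒≯ (∣p∣≤n (vis g)))
  grow (suc k) g I n<k with frontier? g
  ... | yes (u , w , vu , vw , uw) =
          grow k (attach g u w) (attach-invariant g u w I vu vw uw)
               (subst (n <_) (trans (+-suc _ k) (cong (_+ k) (sym (∣⁅x⁆∪p∣≡1+∣p∣ w (vis g) vw)))) n<k)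
  ... | no none = g , I , closed
    where
    closed : Closed g
    closed u w vu uw with lookup (vis g) w in vw
    ... | true  = refl
    ... | false = contradiction (u , w , vu , vw , uw) none

  reach : ∀ g → Closed g → ∀ {a x} → Visited g a → Walk T a x → Visited g x
  reach g closed va here         = va
  reach g closed va (step au wx) = reach g closed (closed _ _ va au) wx

spanningTree : (T : Graph n) → Connected T → (r : Fin n) → Σ (Rooted n r) (ParentEdges T)
spanningTree {n} T connected r = record
  { par = par g ; dep = dep g ; par-r = par-r I ; dep-r = dep-r I
  ; dep-par = λ x → dep-par I x (all-visited x)
  ; dep<n = λ x → <-≤-trans (dep<∣vis∣ I x (all-visited x)) (∣p∣≤n (vis g)) }
  , λ x → par-adj I x (all-visited x)
  where
  open SpanningTree T r
  open Growing
  open Invariant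
  grown = grow n start start-invariant (subst (λ k → n < k + n) (sym (∣⁅x⁆∣≡1 r)) ≤-refl)
  g = proj₁ grown
  I = proj₁ (proj₂ grown)
  all-visited : ∀ x → Visited g x
  all-visited x = reach g (proj₂ (proj₂ grown)) (r-vis I) (connected r x)

ConsecAdj-snoc : (T : Graph n) (ws : List (Fin n)) (b c : Fin n) →
  ConsecAdj T (ws ++ [ b ]) → adj T b c ≡ true → ConsecAdj T ((ws ++ [ b ]) ++ [ c ])
ConsecAdj-snoc T []           b c _          bc = bc , tt
ConsecAdj-snoc T (w ∷ [])     b c (wb , _)   bc = wb , bc , tt
ConsecAdj-snoc T (w ∷ w′ ∷ ws) b c (ww′ , as) bc = ww′ , ConsecAdj-snoc T (w′ ∷ ws) b c as bc

Unique-snoc : (xs : List (Fin n)) (c : Fin n) → Unique xs → All (_≢ c) xs → Unique (xs ++ [ c ])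
Unique-snoc []       c _              _            = [] ∷ []
Unique-snoc (x ∷ xs) c (x∉xs ∷ uxs) (x≢c ∷ xs≢c) = ++⁺ x∉xs (x≢c ∷ []) ∷ Unique-snoc xs c uxs xs≢c

-- In a tree every edge joins a vertex to its parent: otherwise the two tree paths from its ends up to
-- their lowest common ancestor close a cycle with it.
module Acyclic {r : Fin n} (T : Graph n) (R : Rooted n r) (parent-adj : ParentEdges T R) where
  open Rooted R
  open RootedTheory R

  par-adj : ∀ x → x ≢ r → adj T (par x) x ≡ true
  par-adj x x≢r = trans (Graph.sym T (par x) x) (parent-adj x x≢r)

  ≢r-of-⋠ : ∀ {a b} → ¬ b ≼ a → a ≢ r
  ≢r-of-⋠ {b = b} b⋠a refl = b⋠a (≼-root b)

  par∉ : ∀ a b (I : List (Fin n)) → a ≢ r → ¬ a ≼ b → All (λ y → ¬ a ≼ y) I → All (par a ≢_) (a ∷ I ++ [ b ])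
  par∉ a b I a≢r a⋠b I⋡a =
    par≢ a a≢r ∷ ++⁺ (All.map (λ a⋠y e → a⋠y (subst (a ≼_) e (up a≢r here))) I⋡a)
                     ((λ e → a⋠b (subst (a ≼_) e (up a≢r here))) ∷ [])

  -- A path a ∷ I ++ [ b ] between incomparable a and b avoiding their ancestors: climb from the deeper end
  -- until both ends have the same parent, which closes the cycle.
  close-at-lca : ∀ (m : ℕ) a b (I : List (Fin n)) → dep a + dep b ≤ m → ¬ a ≼ b → ¬ b ≼ a →
    All (λ y → ¬ a ≼ y × ¬ b ≼ y) I → Unique (a ∷ I ++ [ b ]) → ConsecAdj T (a ∷ I ++ [ b ]) → HasCycle T
  close-at-lca m a b I d≤m a⋠b b⋠a I⋡ U C with par a ≟ par b
  ... | yes pa≡pb = par a , (a ∷ I ++ [ b ]) , s≤s (length-snoc I) , par∉ a b I a≢r a⋠b (All.map proj₁ I⋡) ∷ U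
                  , par-adj a a≢r , ConsecAdj-snoc T (a ∷ I) b (par a) C (subst (λ z → adj T b z ≡ true) (sym pa≡pb) (parent-adj b b≢r))
    where
    a≢r = ≢r-of-⋠ b⋠a
    b≢r = ≢r-of-⋠ a⋠b
    length-snoc : ∀ (xs : List (Fin n)) → 1 ≤ length (xs ++ [ b ])
    length-snoc []       = s≤s z≤n
    length-snoc (_ ∷ xs) = m≤n⇒m≤1+n (length-snoc xs)
  ... | no pa≢pb with dep b ≤? dep a
  close-at-lca zero a b I d≤m a⋠b b⋠a I⋡ U C | no _ | yes _ =
    contradiction (dep≡0⇒root a (n≤0⇒n≡0 (≤-trans (m≤m+n _ _) d≤m))) (≢r-of-⋠ b⋠a)
  close-at-lca (suc m) a b I d≤m a⋠b b⋠a I⋡ U C | no pa≢pb | yes db≤da =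
    close-at-lca m (par a) b (a ∷ I) d≤m′ pa⋠b b⋠pa I⋡′ (par∉ a b I a≢r a⋠b (All.map proj₁ I⋡) ∷ U) (par-adj a a≢r , C)
    where
    a≢r = ≢r-of-⋠ b⋠a
    d≤m′ : dep (par a) + dep b ≤ m
    d≤m′ = ≤-pred (≤-trans (+-monoˡ-≤ (dep b) (dep-par-< a a≢r)) d≤m)
    pa≢b : par a ≢ b
    pa≢b e = a⋠b (subst (a ≼_) e (up a≢r here))
    pa⋠b : ¬ par a ≼ b
    pa⋠b pa≼b = a⋠b (up a≢r pa≼b)
    b⋠pa : ¬ b ≼ par a
    b⋠pa b≼pa = pa≢pb (≼-one-up b≼pa (≤-antisym (≼-dep-< b≼pa pa≢b)
                                                 (≤-trans db≤da (≤-reflexive (sym (dep-par a a≢r))))))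
    I⋡′ : All (λ y → ¬ par a ≼ y × ¬ b ≼ y) (a ∷ I)
    I⋡′ = ((λ pa≼a → <-irrefl refl (≤-<-trans (≼-dep pa≼a) (dep-par-< a a≢r))) , b⋠a)
        ∷ All.map (λ { (a⋠y , b⋠y) → (λ pa≼y → a⋠y (up a≢r pa≼y)) , b⋠y }) I⋡
  close-at-lca zero a b I d≤m a⋠b b⋠a I⋡ U C | no _ | no _ =
    contradiction (dep≡0⇒root b (n≤0⇒n≡0 (≤-trans (m≤n+m _ _) d≤m))) (≢r-of-⋠ a⋠b)
  close-at-lca (suc m) a b I d≤m a⋠b b⋠a I⋡ U C | no pa≢pb | no db≰da =
    close-at-lca m a (par b) (I ++ [ b ]) d≤m′ a⋠pb pb⋠a I⋡′ U′ C′
    where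
    b≢r = ≢r-of-⋠ a⋠b
    d≤m′ : dep a + dep (par b) ≤ m
    d≤m′ = ≤-pred (≤-trans (+-monoʳ-< (dep a) (dep-par-< b b≢r)) d≤m)
    a≢pb : a ≢ par b
    a≢pb e = b⋠a (subst (b ≼_) (sym e) (up b≢r here))
    a⋠pb : ¬ a ≼ par b
    a⋠pb a≼pb = <-irrefl refl (≤-trans (s≤s (≼-dep-< a≼pb (λ e → a≢pb (sym e))))
                                       (≤-trans (≰⇒> db≰da) (≤-reflexive (sym (dep-par b b≢r)))))
    pb⋠a : ¬ par b ≼ a
    pb⋠a pb≼a = b⋠a (up b≢r pb≼a)
    I⋡′ : All (λ y → ¬ a ≼ y × ¬ par b ≼ y) (I ++ [ b ])
    I⋡′ = ++⁺ (All.map (λ { (a⋠y , b⋠y) → a⋠y , (λ pb≼y → b⋠y (up b≢r pb≼y)) }) I⋡)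
              ((a⋠b , (λ pb≼b → <-irrefl refl (≤-<-trans (≼-dep pb≼b) (dep-par-< b b≢r)))) ∷ [])
    U′ : Unique ((a ∷ I ++ [ b ]) ++ [ par b ])
    U′ = Unique-snoc (a ∷ I ++ [ b ]) (par b) U
           (a≢pb ∷ ++⁺ (All.map (λ { (_ , b⋠y) e → b⋠y (subst (b ≼_) (sym e) (up b≢r here)) }) I⋡)
                       ((λ e → par≢ b b≢r (sym e)) ∷ []))
    C′ : ConsecAdj T ((a ∷ I ++ [ b ]) ++ [ par b ])
    C′ = ConsecAdj-snoc T (a ∷ I) b (par b) C (parent-adj b b≢r)

  ≼-≢r : ∀ {y u} → y ≼ u → y ≢ u → y ≢ r
  ≼-≢r {u = u} y≼u y≢u refl = y≢u (sym (dep≡0⇒root u (n≤0⇒n≡0 (≤-trans (≼-dep y≼u) (≤-reflexive dep-r)))))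

  path-up : ∀ k y u → dep y ≤ k → y ≼ u → y ≢ u →
    Σ (List (Fin n)) λ rest → ConsecAdj T (y ∷ rest ++ [ u ]) × Unique (y ∷ rest)
      × All (λ z → dep u < dep z × dep z ≤ dep y) (y ∷ rest) × (par y ≢ u → 1 ≤ length rest)
  path-up k y u d≤k y≼u y≢u with par y ≟ u
  ... | yes py≡u = [] , (subst (λ z → adj T y z ≡ true) py≡u (parent-adj y (≼-≢r y≼u y≢u)) , tt) , [] ∷ []
                 , (≼-dep-< y≼u (λ e → y≢u (sym e)) , ≤-refl) ∷ [] , λ py≢u → contradiction py≡u py≢u
  path-up zero    y u d≤k y≼u y≢u | no _ = contradiction (dep≡0⇒root y (n≤0⇒n≡0 d≤k)) (≼-≢r y≼u y≢u)
  path-up (suc k) y u d≤k y≼u y≢u | no py≢u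
    with path-up k (par y) u (≤-pred (≤-trans (dep-par-< y y≢r) d≤k)) (≼-par y≼u (λ e → y≢u (sym e))) py≢u
    where y≢r = ≼-≢r y≼u y≢u
  ... | rest , C , U , D , _ =
        par y ∷ rest , (parent-adj y y≢r , C)
      , All.map (λ { (_ , z≤py) e → <-irrefl refl (≤-<-trans (subst (λ z → dep z ≤ dep (par y)) (sym e) z≤py)
                                                             (dep-par-< y y≢r)) }) D ∷ U
      , (≼-dep-< y≼u (λ e → y≢u (sym e)) , ≤-refl)
        ∷ All.map (λ { (u<z , z≤py) → u<z , ≤-trans z≤py (<⇒≤ (dep-par-< y y≢r)) }) D
      , λ _ → s≤s z≤n
    where y≢r = ≼-≢r y≼u y≢u

  close-at-ancestor : ∀ u w → adj T u w ≡ true → w ≼ u → w ≢ u → par w ≢ u → HasCycle T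
  close-at-ancestor u w uw w≼u w≢u pw≢u with path-up (dep w) w u ≤-refl w≼u w≢u
  ... | rest , C , U , D , long = u , (w ∷ rest) , s≤s (long pw≢u)
      , All.map (λ { (u<z , _) e → <-irrefl (cong dep e) u<z }) D ∷ U , (uw , C)

  adj⇒≢ : ∀ {u w} → adj T u w ≡ true → u ≢ w
  adj⇒≢ {u} uw refl = contradiction (trans (sym uw) (Graph.irrefl T u)) λ ()

  non-parent-edge⇒cycle : ∀ u w → dep u ≤ dep w → adj T u w ≡ true → par u ≢ w → par w ≢ u → HasCycle T
  non-parent-edge⇒cycle u w du≤dw uw pu≢w pw≢u with w ≼? u
  ... | yes w≼u = close-at-ancestor u w uw w≼u (λ e → adj⇒≢ uw (sym e)) pw≢u
  ... | no  w⋠u = close-at-lca (dep u + dep w) u w [] ≤-refl u⋠w w⋠u [] ((adj⇒≢ uw ∷ []) ∷ [] ∷ []) (uw , tt)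
    where
    u⋠w : ¬ u ≼ w
    u⋠w u≼w = adj⇒≢ uw (sym (≼-dep-≡ u≼w (≤-antisym (≼-dep u≼w) du≤dw)))

  edge⇒parent-edge : ¬ HasCycle T → ∀ u w → adj T u w ≡ true → par u ≡ w ⊎ par w ≡ u
  edge⇒parent-edge acyclic u w uw with par u ≟ w | par w ≟ u
  ... | yes pu≡w | _        = inj₁ pu≡w
  ... | no _     | yes pw≡u = inj₂ pw≡u
  ... | no pu≢w  | no pw≢u with dep u ≤? dep w
  ...   | yes du≤dw = contradiction (non-parent-edge⇒cycle u w du≤dw uw pu≢w pw≢u) acyclic
  ...   | no  du≰dw = contradiction (non-parent-edge⇒cycle w u (<⇒≤ (≰⇒> du≰dw)) (trans (Graph.sym T w u) uw) pw≢u pu≢w) acyclic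

  adj-par⇒≢r : ∀ {u} → adj T u (par u) ≡ true → u ≢ r
  adj-par⇒≢r {u} u-pu refl = adj⇒≢ u-pu (sym par-r)

  edges-covered : ¬ HasCycle T → (F : List (List (Fin n))) → (∀ x → x ≢ r → coverParity F x (par x) ≡ true) →
                  ∀ u v → adj T u v ≡ true → coverParity F u v ≡ true
  edges-covered acyclic F covered u v uv with edge⇒parent-edge acyclic u v uv
  ... | inj₁ refl = covered u (adj-par⇒≢r uv)
  ... | inj₂ refl = trans (coverParity-sym F (par v) v) (covered v (adj-par⇒≢r (trans (Graph.sym T v (par v)) uv)))

-- Subtrees and the edges they induce

module InducedEdges {r : Fin n} (R : Rooted n r) where
  open Rooted R
  open RootedTheory R

  -- Every vertex x ≢ r stands for its parent edge x – par x.
  edgeIn : List (Fin n) → Fin n → Bool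
  edgeIn X x = x ∈ᵇ X ∧ par x ∈ᵇ X

  coverParity-snoc : ∀ F X x → coverParity (F ++ [ X ]) x (par x) ≡ coverParity F x (par x) xor edgeIn X x
  coverParity-snoc F X x = trans (coverParity-++ F [ X ] x (par x)) (cong (coverParity F x (par x) xor_) (xor-identityʳ _))

  Induces : List (Fin n) → List (Fin n) → Set
  Induces X ys = ∀ x → x ≢ r → edgeIn X x ≡ parity ys x

  subtree-induces : ∀ t ys → All (λ y → par y ∈ t ∷ ys × dep t < dep y) ys → Unique (t ∷ ys) → Induces (t ∷ ys) ys
  subtree-induces t ys ys-ok (t∉ys ∷ uys) x x≢r rewrite parity-Unique ys uys x with x ≟ t
  ... | yes refl = trans (∉⇒∈ᵇ (x ∷ ys) (par≢ x x≢r ∷ All.map par-shallower ys-ok)) (sym (∉⇒∈ᵇ ys t∉ys))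
    where
    par-shallower : ∀ {y} → par y ∈ x ∷ ys × dep x < dep y → par x ≢ y
    par-shallower (_ , x<y) refl = <-asym x<y (dep-par-< x x≢r)
  ... | no x≢t with x ∈ᵇ ys in x∈ys
  ...   | true  = ∈⇒∈ᵇ (proj₁ (∈ᵇ⇒All ys ys-ok x x∈ys))
  ...   | false = refl

  NoEdgeFrom : List (Fin n) → List (Fin n) → Set
  NoEdgeFrom X Y = ∀ y → y ∈ᵇ X ≡ true → y ≢ r → par y ∈ᵇ Y ≡ false

  union-induces : ∀ X₁ ys₁ X₂ ys₂ → Induces X₁ ys₁ → Induces X₂ ys₂ →
    (∀ y → y ∈ᵇ X₁ ≡ true → y ∈ᵇ X₂ ≡ false) → NoEdgeFrom X₁ X₂ → NoEdgeFrom X₂ X₁ →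
    Induces (X₁ ++ X₂) (ys₁ ++ ys₂)
  union-induces X₁ ys₁ X₂ ys₂ ind₁ ind₂ disjoint no₁₂ no₂₁ x x≢r
    rewrite ∈ᵇ-++ x X₁ X₂ | ∈ᵇ-++ (par x) X₁ X₂ | parity-++ ys₁ ys₂ x | sym (ind₁ x x≢r) | sym (ind₂ x x≢r)
    with x ∈ᵇ X₁ in x∈X₁
  ... | true  rewrite disjoint x x∈X₁ | no₁₂ x x∈X₁ x≢r = trans (∨-identityʳ _) (sym (xor-identityʳ _))
  ... | false with x ∈ᵇ X₂ in x∈X₂
  ...   | false = refl
  ...   | true rewrite no₂₁ x x∈X₂ x≢r = refl

  grandchild-< : ∀ {t y z} → IsChild t y → IsChild y z → dep t < dep z
  grandchild-< ty yz = <-trans (child-< ty) (child-< yz)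

  edge-induces : ∀ {t y} → IsChild t y → Induces (t ∷ y ∷ []) (y ∷ [])
  edge-induces {t} {y} ty = subtree-induces t (y ∷ []) ((here (proj₁ ty) , child-< ty) ∷ [])
    ((dep-<⇒≢ (child-< ty) ∷ []) ∷ [] ∷ [])

  path₃-induces : ∀ {t y z} → IsChild t y → IsChild y z → Induces (t ∷ y ∷ z ∷ []) (y ∷ z ∷ [])
  path₃-induces {t} {y} {z} ty yz = subtree-induces t (y ∷ z ∷ [])
    ((here (proj₁ ty) , child-< ty) ∷ (there (here (proj₁ yz)) , grandchild-< ty yz) ∷ [])
    ((dep-<⇒≢ (child-< ty) ∷ dep-<⇒≢ (grandchild-< ty yz) ∷ []) ∷ (dep-<⇒≢ (child-< yz) ∷ []) ∷ [] ∷ [])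

  path₄-induces : ∀ {t y z w} → IsChild t y → IsChild y z → IsChild z w →
                  Induces (t ∷ y ∷ z ∷ w ∷ []) (y ∷ z ∷ w ∷ [])
  path₄-induces {t} {y} {z} {w} ty yz zw = subtree-induces t (y ∷ z ∷ w ∷ [])
    ((here (proj₁ ty) , child-< ty) ∷ (there (here (proj₁ yz)) , grandchild-< ty yz)
      ∷ (there (there (here (proj₁ zw))) , <-trans (grandchild-< ty yz) (child-< zw)) ∷ [])
    ((dep-<⇒≢ (child-< ty) ∷ dep-<⇒≢ (grandchild-< ty yz) ∷ dep-<⇒≢ (<-trans (grandchild-< ty yz) (child-< zw)) ∷ [])
      ∷ (dep-<⇒≢ (child-< yz) ∷ dep-<⇒≢ (grandchild-< yz zw) ∷ []) ∷ (dep-<⇒≢ (child-< zw) ∷ []) ∷ [] ∷ [])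

  claw-induces : ∀ {t u w c} → IsChild t u → IsChild t w → IsChild t c → u ≢ w → u ≢ c → w ≢ c →
                 Induces (t ∷ u ∷ w ∷ c ∷ []) (u ∷ w ∷ c ∷ [])
  claw-induces {t} {u} {w} {c} tu tw tc u≢w u≢c w≢c = subtree-induces t (u ∷ w ∷ c ∷ [])
    ((here (proj₁ tu) , child-< tu) ∷ (here (proj₁ tw) , child-< tw) ∷ (here (proj₁ tc) , child-< tc) ∷ [])
    ((dep-<⇒≢ (child-< tu) ∷ dep-<⇒≢ (child-< tw) ∷ dep-<⇒≢ (child-< tc) ∷ [])
      ∷ (u≢w ∷ u≢c ∷ []) ∷ (w≢c ∷ []) ∷ [] ∷ [])

  upper-claw-induces : ∀ {t y u w} → IsChild t y → IsChild y u → IsChild y w → u ≢ w →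
                       Induces (t ∷ y ∷ u ∷ w ∷ []) (y ∷ u ∷ w ∷ [])
  upper-claw-induces {t} {y} {u} {w} ty yu yw u≢w = subtree-induces t (y ∷ u ∷ w ∷ [])
    ((here (proj₁ ty) , child-< ty) ∷ (there (here (proj₁ yu)) , grandchild-< ty yu)
      ∷ (there (here (proj₁ yw)) , grandchild-< ty yw) ∷ [])
    ((dep-<⇒≢ (child-< ty) ∷ dep-<⇒≢ (grandchild-< ty yu) ∷ dep-<⇒≢ (grandchild-< ty yw) ∷ [])
      ∷ (dep-<⇒≢ (child-< yu) ∷ dep-<⇒≢ (child-< yw) ∷ []) ∷ (u≢w ∷ []) ∷ [] ∷ [])

  hook-induces : ∀ {t u c d} → IsChild t u → IsChild t c → IsChild c d → u ≢ c →
                 Induces (t ∷ u ∷ c ∷ d ∷ []) (u ∷ c ∷ d ∷ [])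
  hook-induces {t} {u} {c} {d} tu tc cd u≢c = subtree-induces t (u ∷ c ∷ d ∷ [])
    ((here (proj₁ tu) , child-< tu) ∷ (here (proj₁ tc) , child-< tc) ∷ (there (there (here (proj₁ cd))) , grandchild-< tc cd) ∷ [])
    ((dep-<⇒≢ (child-< tu) ∷ dep-<⇒≢ (child-< tc) ∷ dep-<⇒≢ (grandchild-< tc cd) ∷ [])
      ∷ (u≢c ∷ dep-<⇒≢ (subst (_< dep d) (sym (trans (dep-child tu) (sym (dep-child tc)))) (child-< cd)) ∷ [])
      ∷ (dep-<⇒≢ (child-< cd) ∷ []) ∷ [] ∷ [])

  two-edges-induce : ∀ {s t a b} → IsChild s t → IsChild a b →
    All (λ y → All (y ≢_) (a ∷ b ∷ [])) (s ∷ t ∷ []) →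
    (s ≢ r → All (par s ≢_) (a ∷ b ∷ [])) → (a ≢ r → All (par a ≢_) (s ∷ t ∷ [])) →
    Induces (s ∷ t ∷ a ∷ b ∷ []) (t ∷ b ∷ [])
  two-edges-induce {s} {t} {a} {b} st ab disjoint s-far a-far =
    union-induces (s ∷ t ∷ []) (t ∷ []) (a ∷ b ∷ []) (b ∷ [])
      (edge-induces st) (edge-induces ab)
      (λ y y∈ → ∉⇒∈ᵇ (a ∷ b ∷ []) (∈ᵇ⇒All (s ∷ t ∷ []) disjoint y y∈))
      (λ y y∈ → ∈ᵇ⇒All (s ∷ t ∷ []) ((λ s≢r → ∉⇒∈ᵇ _ (s-far s≢r))
                                    ∷ (λ _ → subst (λ z → z ∈ᵇ (a ∷ b ∷ []) ≡ false) (sym (proj₁ st)) (∉⇒∈ᵇ _ (All.head disjoint)))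
                                    ∷ []) y y∈)
      (λ y y∈ → ∈ᵇ⇒All (a ∷ b ∷ []) ((λ a≢r → ∉⇒∈ᵇ _ (a-far a≢r))
                                    ∷ (λ _ → subst (λ z → z ∈ᵇ (s ∷ t ∷ []) ≡ false) (sym (proj₁ ab))
                                                   (∉⇒∈ᵇ _ (All.map (λ y≢ab y≡a → All.head y≢ab (sym y≡a)) disjoint)))
                                    ∷ []) y y∈)

  subtrees-par-≢ : ∀ {p o o′ x y} → IsChild p o → IsChild p o′ → o ≢ o′ → x ≼ o → x ≢ r → y ≼ o′ → par x ≢ y
  subtrees-par-≢ po po′ o≢o′ here         _ y≼o′ e = <-irrefl (cong dep (trans (sym (proj₁ po)) e))
                                                              (<-≤-trans (child-< po′) (≼-dep y≼o′))
  subtrees-par-≢ po po′ o≢o′ (up _ px≼o) _ y≼o′ = ≼-siblings px≼o y≼o′ po po′ o≢o′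

  separated-edges-induce : ∀ {p o o′ a b a′ b′} → IsChild p o → IsChild p o′ → o ≢ o′ →
    IsChild a b → a ≼ o → IsChild a′ b′ → a′ ≼ o′ → Induces (a ∷ b ∷ a′ ∷ b′ ∷ []) (b ∷ b′ ∷ [])
  separated-edges-induce po po′ o≢o′ ab a≼o a′b′ a′≼o′ =
    two-edges-induce ab a′b′
      ((sep a≼o a′≼o′ ∷ sep a≼o b′≼o′ ∷ []) ∷ (sep b≼o a′≼o′ ∷ sep b≼o b′≼o′ ∷ []) ∷ [])
      (λ a≢r → subtrees-par-≢ po po′ o≢o′ a≼o a≢r a′≼o′ ∷ subtrees-par-≢ po po′ o≢o′ a≼o a≢r b′≼o′ ∷ [])
      (λ a′≢r → subtrees-par-≢ po′ po o′≢o a′≼o′ a′≢r a≼o ∷ subtrees-par-≢ po′ po o′≢o a′≼o′ a′≢r b≼o ∷ [])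
    where
    sep = λ {x} {y} (x≼o : x ≼ _) (y≼o′ : y ≼ _) → ≼-siblings x≼o y≼o′ po po′ o≢o′
    o′≢o = ≢-sym o≢o′
    b≼o = up (proj₂ ab) (subst (_≼ _) (sym (proj₁ ab)) a≼o)
    b′≼o′ = up (proj₂ a′b′) (subst (_≼ _) (sym (proj₁ a′b′)) a′≼o′)

bit : Bool → ℕ
bit true  = 1
bit false = 0

sumOver : (A → ℕ) → List A → ℕ
sumOver f []       = 0
sumOver f (x ∷ xs) = f x + sumOver f xs

sumOver-zero : (f : A → ℕ) (xs : List A) → All (λ x → f x ≡ 0) xs → sumOver f xs ≡ 0
sumOver-zero f []       []             = refl
sumOver-zero f (x ∷ xs) (fx≡0 ∷ fxs≡0) rewrite fx≡0 = sumOver-zero f xs fxs≡0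

sumOver-cong : (f g : A → ℕ) (xs : List A) → All (λ x → f x ≡ g x) xs → sumOver f xs ≡ sumOver g xs
sumOver-cong f g []       []           = refl
sumOver-cong f g (x ∷ xs) (fx≡gx ∷ fg) = cong₂ _+_ fx≡gx (sumOver-cong f g xs fg)

sumOver-+ : (f g : A → ℕ) (xs : List A) → sumOver (λ x → f x + g x) xs ≡ sumOver f xs + sumOver g xs
sumOver-+ f g []       = refl
sumOver-+ f g (x ∷ xs) rewrite sumOver-+ f g xs =
  ℕ-solve 4 (λ a b c d → (a :+ b) :+ (c :+ d) := (a :+ c) :+ (b :+ d)) refl (f x) (g x) (sumOver f xs) (sumOver g xs)

sumOver-mono : (f g : A → ℕ) (xs : List A) → (∀ x → f x ≤ g x) → sumOver f xs ≤ sumOver g xs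
sumOver-mono f g []       f≤g = z≤n
sumOver-mono f g (x ∷ xs) f≤g = +-mono-≤ (f≤g x) (sumOver-mono f g xs f≤g)

sumOver-1 : (xs : List A) → sumOver (λ _ → 1) xs ≡ length xs
sumOver-1 []       = refl
sumOver-1 (x ∷ xs) = cong suc (sumOver-1 xs)

sumOver-== : (xs : List (Fin n)) → Unique xs → {y : Fin n} → y ∈ xs → sumOver (λ x → bit (x == y)) xs ≡ 1
sumOver-== (x ∷ xs) (x∉xs ∷ _) (here refl) rewrite ==-refl x =
  cong suc (sumOver-zero _ xs (All.map (λ x≢z → cong bit (==-false λ z≡x → x≢z (sym z≡x))) x∉xs))
sumOver-== (x ∷ xs) (x∉xs ∷ uxs) (there y∈xs) rewrite ==-false (All.lookup x∉xs y∈xs) = sumOver-== xs uxs y∈xs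

odd : ℕ → Bool
odd zero    = false
odd (suc k) = not (odd k)

occ : Fin n → List (Fin n) → ℕ
occ x []       = 0
occ x (y ∷ ys) = bit (x == y) + occ x ys

occ-++ : (x : Fin n) (xs ys : List (Fin n)) → occ x (xs ++ ys) ≡ occ x xs + occ x ys
occ-++ x []       ys = refl
occ-++ x (y ∷ xs) ys = trans (cong (bit (x == y) +_) (occ-++ x xs ys)) (sym (+-assoc (bit (x == y)) (occ x xs) (occ x ys)))

parity-occ : (xs : List (Fin n)) (x : Fin n) → parity xs x ≡ odd (occ x xs)
parity-occ []       x = refl
parity-occ (y ∷ xs) x with x == y
... | true  = cong not (parity-occ xs x)
... | false = parity-occ xs x

length-occ : (xs : List (Fin n)) → length xs ≡ sumOver (λ x → occ x xs) (allFin n)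
length-occ {n} []       = sym (sumOver-zero _ (allFin n) (All.tabulate λ _ → refl))
length-occ {n} (y ∷ xs) = begin
  suc (length xs)
    ≡⟨ cong₂ _+_ (sym (sumOver-== (allFin n) (allFin⁺ n) (∈-allFin y))) (length-occ xs) ⟩
  sumOver (λ x → bit (x == y)) (allFin n) + sumOver (λ x → occ x xs) (allFin n)
    ≡⟨ sym (sumOver-+ _ _ (allFin n)) ⟩
  sumOver (λ x → occ x (y ∷ xs)) (allFin n) ∎
  where open ≡-Reasoning

module Children {r : Fin n} (R : Rooted n r) where
  open Rooted R
  open RootedTheory R

  isChild? : ∀ p c → Dec (IsChild p c)
  isChild? p c = (par c ≟ p) ×-dec ¬? (c ≟ r)

  children : Fin n → List (Fin n)
  children p = filter (isChild? p) (allFin n)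

  children-IsChild : ∀ p → All (IsChild p) (children p)
  children-IsChild p = all-filter (isChild? p) (allFin n)

  children-Unique : ∀ p → Unique (children p)
  children-Unique p = Unique.filter⁺ (isChild? p) (allFin⁺ n)

  ∈-children : ∀ {p c} → IsChild p c → c ∈ children p
  ∈-children pc = ∈-filter⁺ (isChild? _) (∈-allFin _) pc

  below : Fin n → Fin n → Bool
  below x c = does (x ≼? c)

  -- every proper descendant of p lies below exactly one child of p
  occ-children : ∀ p x (x≡p? : Dec (x ≡ p)) (x≼p? : Dec (x ≼ p)) →
                 bit (does x≡p?) + sumOver (λ c → bit (below x c)) (children p) ≡ bit (does x≼p?)
  occ-children p x (yes refl) (yes _)   = cong suc (sumOver-zero _ (children p) (All.map not-below-child (children-IsChild p)))
    where
    not-below-child : ∀ {c} → IsChild p c → bit (below p c) ≡ 0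
    not-below-child pc = cong bit (dec-false (p ≼? _) λ p≼c → <-irrefl refl (≤-<-trans (≼-dep p≼c) (child-< pc)))
  occ-children p x (yes refl) (no p⋠p)  = contradiction here p⋠p
  occ-children p x (no _)     (no x⋠p)  = sumOver-zero _ (children p) (All.map not-below-child (children-IsChild p))
    where
    not-below-child : ∀ {c} → IsChild p c → bit (below x c) ≡ 0
    not-below-child pc = cong bit (dec-false (x ≼? _) λ x≼c → x⋠p (≼-child x≼c pc))
  occ-children p x (no x≢p)   (yes x≼p) with ≼-child-of x≼p x≢p
  ... | c₀ , pc₀ , x≼c₀ = trans (sumOver-cong _ _ (children p) (All.map below-c₀ (children-IsChild p)))
                                (sumOver-== (children p) (children-Unique p) (∈-children pc₀))
    where
    below-c₀ : ∀ {c} → IsChild p c → bit (below x c) ≡ bit (c == c₀)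
    below-c₀ {c} pc with x ≼? c | c ≟ c₀
    ... | yes _   | yes _    = refl
    ... | no _    | no _     = refl
    ... | yes x≼c | no c≢c₀  = contradiction (≼-unique x≼c x≼c₀ (trans (dep-child pc) (sym (dep-child pc₀)))) c≢c₀
    ... | no x⋠c  | yes refl = contradiction x≼c₀ x⋠c

-- The greedy covering

module Greedy {r : Fin n} (R : Rooted n r) where
  open Rooted R
  open Children R

  -- What the subtree of a child c of p leaves open, as the lower ends of the open edges. Besides the
  -- edge c – p these are floats (single edges not touching c) and edges hanging below c.
  data Out : Set where
    closed      : Out
    float       : (a b : Fin n) → Out
    edge        : Out
    edge+float  : (a b : Fin n) → Out
    spider      : (u u′ v v′ : Fin n) → Out
    path        : (d : Fin n) → Out
    path+float  : (d a b : Fin n) → Out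

  opens : Fin n → Out → List (Fin n)
  opens c closed             = []
  opens c (float a b)        = b ∷ []
  opens c edge               = c ∷ []
  opens c (edge+float a b)   = c ∷ b ∷ []
  opens c (spider u u′ v v′) = c ∷ u ∷ u′ ∷ v ∷ v′ ∷ []
  opens c (path d)           = c ∷ d ∷ []
  opens c (path+float d a b) = c ∷ d ∷ b ∷ []

  floats : Out → ℕ
  floats (float _ _)        = 1
  floats (edge+float _ _)   = 1
  floats (path+float _ _ _) = 1
  floats _                  = 0

  record Result : Set where
    constructor result
    field
      out   : Out
      sets  : List (List (Fin n))
      verts : List (Fin n)
  open Result public

  -- the open edges c – p (legs) or paths d – c – p collected at p so far
  data Stock : Set where
    idle   : Stock
    leg    : (u : Fin n) → Stock
    legs   : (u w : Fin n) → Stock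
    path₁  : (c d : Fin n) → Stock
    path₂  : (u d₁ v d₂ : Fin n) → Stock

  -- at most one float a – b waiting for a partner, together with the child o below which it lies
  data Pool : Set where
    empty   : Pool
    holding : (o a b : Fin n) → Pool

  record State : Set where
    constructor state
    field
      sets   : List (List (Fin n))
      verts  : List (Fin n)
      stock  : Stock
      pool   : Pool
      paths  : List (Fin n × Fin n)
  open State public

  -- two floats below different children induce just their two edges
  addFloat : List (List (Fin n)) → Pool → Fin n → Fin n → Fin n → List (List (Fin n)) × Pool
  addFloat F empty             o a b = F , holding o a b
  addFloat F (holding o′ a′ b′) o a b = F ++ [ a′ ∷ b′ ∷ a ∷ b ∷ [] ] , empty

  addLeg : Fin n → List (List (Fin n)) → Stock → Fin n → List (List (Fin n)) × Stock
  addLeg p F idle      c = F , leg c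
  addLeg p F (leg u)    c = F , legs u c
  addLeg p F (legs u w) c = F ++ [ p ∷ u ∷ w ∷ c ∷ [] ] , idle
  addLeg p F k          c = F , k

  absorb : Fin n → State → Fin n → Result → State
  absorb p s c R with out R
  ... | closed = state (sets s ++ sets R) (verts s ++ verts R) (stock s) (pool s) (paths s)
  ... | float a b =
          let F′ , pl′ = addFloat (sets s ++ sets R) (pool s) c a b
          in  state F′ (verts s ++ verts R) (stock s) pl′ (paths s)
  ... | edge =
          let F′ , k′ = addLeg p (sets s ++ sets R) (stock s) c
          in  state F′ (verts s ++ verts R) k′ (pool s) (paths s)
  ... | edge+float a b =
          let F′ , pl′ = addFloat (sets s ++ sets R) (pool s) c a b
              F″ , k′  = addLeg p F′ (stock s) c
          in  state F″ (verts s ++ verts R) k′ pl′ (paths s)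
  ... | spider u u′ v v′ =
          let F′ , pl′ = addFloat ((sets s ++ sets R) ++ [ c ∷ v ∷ u ∷ u′ ∷ [] ]) (pool s) c v v′
              F″ , k′  = addLeg p F′ (stock s) c
          in  state F″ (verts s ++ verts R) k′ pl′ (paths s)
  ... | path d = state (sets s ++ sets R) (verts s ++ verts R) (stock s) (pool s) ((c , d) ∷ paths s)
  ... | path+float d a b =
          let F′ , pl′ = addFloat (sets s ++ sets R) (pool s) c a b
          in  state F′ (verts s ++ verts R) (stock s) pl′ ((c , d) ∷ paths s)

  absorbAll : Fin n → (Fin n → Result) → State → List (Fin n) → State
  absorbAll p results s []       = s
  absorbAll p results s (c ∷ cs) = absorbAll p results (absorb p s c (results c)) cs

  origin? : Pool → Fin n → Bool
  origin? empty           v = false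
  origin? (holding o _ _) v = o == v

  -- Two paths u – p – v with tails d₁, d₂: a hook covers three of the four edges and the last one
  -- becomes a float, broken off below a different child than the pooled float.
  split : Fin n → Pool → Fin n → Fin n → Fin n → Fin n → List (Fin n) × Fin n × Fin n
  split p pl u d₁ v d₂ = if origin? pl v then (p ∷ u ∷ v ∷ d₂ ∷ [] , u , d₁)
                                        else (p ∷ v ∷ u ∷ d₁ ∷ [] , v , d₂)

  addPath : Fin n → List (List (Fin n)) → Stock → Pool → Fin n → Fin n → List (List (Fin n)) × Stock × Pool
  addPath p F idle               pl c d = F , path₁ c d , pl
  addPath p F (leg u)            pl c d = F ++ [ p ∷ u ∷ c ∷ d ∷ [] ] , idle , pl
  addPath p F (legs u w)         pl c d = F ++ [ p ∷ w ∷ c ∷ d ∷ [] ] , leg u , pl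
  addPath p F (path₁ u d₁)       pl c d = F , path₂ u d₁ c d , pl
  addPath p F (path₂ u d₁ v d₂) pl c d =
    let X , a , b = split p pl u d₁ v d₂
        F′ , pl′  = addFloat (F ++ [ X ]) pl a a b
    in  F′ , path₁ c d , pl′

  addPaths : Fin n → List (List (Fin n)) → Stock → Pool → List (Fin n × Fin n) → List (List (Fin n)) × Stock × Pool
  addPaths p F k pl []             = F , k , pl
  addPaths p F k pl ((c , d) ∷ cds) = let F′ , k′ , pl′ = addPath p F k pl c d in addPaths p F′ k′ pl′ cds

  finish : Fin n → List (List (Fin n)) → Stock → Pool → Out × List (List (Fin n))
  finish p F idle              empty           = edge , F
  finish p F idle              (holding _ a b) = edge+float a b , F
  finish p F (leg u)           empty           = path u , F
  finish p F (leg u)           (holding _ a b) = path+float u a b , F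
  finish p F (legs u w)        empty           = closed , F ++ [ par p ∷ p ∷ u ∷ w ∷ [] ]
  finish p F (legs u w)        (holding _ a b) = float a b , F ++ [ par p ∷ p ∷ u ∷ w ∷ [] ]
  finish p F (path₁ c d)       empty           = closed , F ++ [ par p ∷ p ∷ c ∷ d ∷ [] ]
  finish p F (path₁ c d)       (holding _ a b) = float a b , F ++ [ par p ∷ p ∷ c ∷ d ∷ [] ]
  finish p F (path₂ u d₁ v d₂) empty           = spider u d₁ v d₂ , F
  finish p F (path₂ u d₁ v d₂) pl@(holding _ _ _) =
    let X , a , b = split p pl u d₁ v d₂
    in  edge , proj₁ (addFloat (F ++ [ X ]) pl a a b)

  node : Fin n → (Fin n → Result) → Result
  node p results =
    let s            = absorbAll p results (state [] [] idle empty []) (children p)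
        F , k , pl   = addPaths p (sets s) (stock s) (pool s) (paths s)
        o , F′       = finish p F k pl
    in  result o F′ (p ∷ verts s)

  -- The fuel only has to exceed the height of the tree; the first clause is never reached.
  greedy : ℕ → Fin n → Result
  greedy zero    c = result closed [] (c ∷ [])
  greedy (suc k) c = node c (greedy k)

module GreedySound {r : Fin n} (R : Rooted n r) where
  open Rooted R
  open RootedTheory R
  open InducedEdges R
  open Children R
  open Greedy R

  Float : Fin n → Fin n → Fin n → Set
  Float c a b = IsChild a b × a ≼ c × a ≢ c

  Shape : Fin n → Out → Set
  Shape c closed             = ⊤
  Shape c (float a b)        = Float c a b
  Shape c edge               = ⊤
  Shape c (edge+float a b)   = Float c a b × par a ≢ c
  Shape c (spider u u′ v v′) = IsChild c u × IsChild u u′ × IsChild c v × IsChild v v′ × u ≢ v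
  Shape c (path d)           = IsChild c d
  Shape c (path+float d a b) = IsChild c d × Float c a b

  -- The sets of res together with its open edges cover every edge of the subtree of c, including c – par c,
  -- an odd number of times; verts res lists that subtree, whose 3 units per vertex pay 8 per set, 3 per
  -- open edge and 1 per float.
  record Sound (c : Fin n) (res : Result) : Set where
    field
      shape      : Shape c (out res)
      coverage   : ∀ x → x ≢ r → coverParity (sets res) x (par x) ≡ parity (verts res) x xor parity (opens c (out res)) x
      budget     : 8 * length (sets res) + 3 * length (opens c (out res)) + floats (out res) ≤ 3 * length (verts res)
      enumerates : ∀ x → occ x (verts res) ≡ bit (below x c)

  stockOpens : Stock → List (Fin n)
  stockOpens idle              = []
  stockOpens (leg u)           = u ∷ []
  stockOpens (legs u w)        = u ∷ w ∷ []
  stockOpens (path₁ c d)       = c ∷ d ∷ []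
  stockOpens (path₂ u d₁ v d₂) = u ∷ d₁ ∷ v ∷ d₂ ∷ []

  poolOpens : Pool → List (Fin n)
  poolOpens empty           = []
  poolOpens (holding _ _ b) = b ∷ []

  pooled : Pool → ℕ
  pooled empty           = 0
  pooled (holding _ _ _) = 1

  pathOpens : List (Fin n × Fin n) → List (Fin n)
  pathOpens []              = []
  pathOpens ((c , d) ∷ cds) = c ∷ d ∷ pathOpens cds

  pending : Stock → Pool → List (Fin n × Fin n) → Fin n → Bool
  pending k pl cds x = (parity (stockOpens k) x xor parity (poolOpens pl) x) xor parity (pathOpens cds) x

  #pending : Stock → Pool → List (Fin n × Fin n) → ℕ
  #pending k pl cds = length (stockOpens k) + length (poolOpens pl) + length (pathOpens cds)

  length-snoc : (F : List (List (Fin n))) (X : List (Fin n)) → length (F ++ [ X ]) ≡ length F + 1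
  length-snoc F X = length-++ F

  PairCond : Fin n → Pool → Fin n → Fin n → Fin n → Set
  PairCond p empty             o a b = ⊤
  PairCond p (holding o′ a′ b′) o a b =
    IsChild p o′ × IsChild p o × o′ ≢ o × IsChild a′ b′ × a′ ≼ o′ × IsChild a b × a ≼ o

  addFloat-covers : ∀ p F pl o a b → PairCond p pl o a b → ∀ x → x ≢ r →
    coverParity (proj₁ (addFloat F pl o a b)) x (par x)
      ≡ coverParity F x (par x) xor ((parity (poolOpens pl) x xor parity (poolOpens (proj₂ (addFloat F pl o a b))) x) xor (x == b))
  addFloat-covers p F empty o a b _ x x≢r =
    xor-solve 2 (λ P B → P ≋ (P ⊕ ((lit false ⊕ (B ⊕ lit false)) ⊕ B))) refl (coverParity F x (par x)) (x == b)
  addFloat-covers p F (holding o′ a′ b′) o a b (po′ , po , o′≢o , a′b′ , a′≼o′ , ab , a≼o) x x≢r =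
    trans (coverParity-snoc F _ x)
      (trans (cong (coverParity F x (par x) xor_) (separated-edges-induce po′ po o′≢o a′b′ a′≼o′ ab a≼o x x≢r))
        (xor-solve 3 (λ P B′ B → P ⊕ (B′ ⊕ (B ⊕ lit false)) ≋ P ⊕ (((B′ ⊕ lit false) ⊕ lit false) ⊕ B)) refl
           (coverParity F x (par x)) (x == b′) (x == b)))

  addFloat-budget : ∀ F pl o a b →
    8 * length (proj₁ (addFloat F pl o a b)) + 3 * length (poolOpens (proj₂ (addFloat F pl o a b))) + pooled (proj₂ (addFloat F pl o a b))
      ≡ 8 * length F + 3 * length (poolOpens pl) + pooled pl + 4
  addFloat-budget F empty             o a b = ℕ-solve 1 (λ f → ℕ-con 8 :* f :+ ℕ-con 3 :+ ℕ-con 1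
                                                           := ℕ-con 8 :* f :+ ℕ-con 0 :+ ℕ-con 0 :+ ℕ-con 4) refl (length F)
  addFloat-budget F (holding o′ a′ b′) o a b rewrite length-snoc F (a′ ∷ b′ ∷ a ∷ b ∷ []) =
    ℕ-solve 1 (λ f → ℕ-con 8 :* (f :+ ℕ-con 1) :+ ℕ-con 0 :+ ℕ-con 0 := ℕ-con 8 :* f :+ ℕ-con 3 :+ ℕ-con 1 :+ ℕ-con 4) refl (length F)

  LegCond : Fin n → Stock → Fin n → Set
  LegCond p idle            c = ⊤
  LegCond p (leg _)         c = ⊤
  LegCond p (legs u w)      c = IsChild p u × IsChild p w × IsChild p c × u ≢ w × u ≢ c × w ≢ c
  LegCond p (path₁ _ _)     c = ⊥
  LegCond p (path₂ _ _ _ _) c = ⊥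

  addLeg-covers : ∀ p F k c → LegCond p k c → ∀ x → x ≢ r →
    coverParity (proj₁ (addLeg p F k c)) x (par x)
      ≡ coverParity F x (par x) xor ((parity (stockOpens k) x xor parity (stockOpens (proj₂ (addLeg p F k c))) x) xor (x == c))
  addLeg-covers p F idle c _ x x≢r =
    xor-solve 2 (λ P C → P ≋ P ⊕ ((lit false ⊕ (C ⊕ lit false)) ⊕ C)) refl (coverParity F x (par x)) (x == c)
  addLeg-covers p F (leg u) c _ x x≢r =
    xor-solve 3 (λ P U C → P ≋ P ⊕ (((U ⊕ lit false) ⊕ (U ⊕ (C ⊕ lit false))) ⊕ C)) refl (coverParity F x (par x)) (x == u) (x == c)
  addLeg-covers p F (legs u w) c (pu , pw , pc , u≢w , u≢c , w≢c) x x≢r =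
    trans (coverParity-snoc F _ x)
      (trans (cong (coverParity F x (par x) xor_) (claw-induces pu pw pc u≢w u≢c w≢c x x≢r))
        (xor-solve 4 (λ P U W C → P ⊕ (U ⊕ (W ⊕ (C ⊕ lit false))) ≋ P ⊕ (((U ⊕ (W ⊕ lit false)) ⊕ lit false) ⊕ C)) refl
          (coverParity F x (par x)) (x == u) (x == w) (x == c)))

  addLeg-budget : ∀ p F k c → LegCond p k c →
    8 * length (proj₁ (addLeg p F k c)) + 3 * length (stockOpens (proj₂ (addLeg p F k c))) ≤ 8 * length F + 3 * length (stockOpens k) + 3
  addLeg-budget p F idle      c _ = ≤-reflexive (ℕ-solve 1 (λ f → ℕ-con 8 :* f :+ ℕ-con 3
                                                              := ℕ-con 8 :* f :+ ℕ-con 0 :+ ℕ-con 3) refl (length F))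
  addLeg-budget p F (leg u)   c _ = ≤-reflexive (ℕ-solve 1 (λ f → ℕ-con 8 :* f :+ ℕ-con 6
                                                              := ℕ-con 8 :* f :+ ℕ-con 3 :+ ℕ-con 3) refl (length F))
  addLeg-budget p F (legs u w) c _ rewrite length-snoc F (p ∷ u ∷ w ∷ c ∷ []) =
    ≤-slack 1 (ℕ-solve 1 (λ f → ℕ-con 8 :* (f :+ ℕ-con 1) :+ ℕ-con 0 :+ ℕ-con 1 := ℕ-con 8 :* f :+ ℕ-con 6 :+ ℕ-con 3) refl (length F))

  PoolOK : Fin n → Pool → Set
  PoolOK p empty           = ⊤
  PoolOK p (holding o a b) = IsChild p o × IsChild a b × a ≼ o

  splitSet : Fin n → Pool → Fin n → Fin n → Fin n → Fin n → List (Fin n)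
  splitSet p pl u d₁ v d₂ = proj₁ (split p pl u d₁ v d₂)

  splitTop splitBottom : Fin n → Pool → Fin n → Fin n → Fin n → Fin n → Fin n
  splitTop    p pl u d₁ v d₂ = proj₁ (proj₂ (split p pl u d₁ v d₂))
  splitBottom p pl u d₁ v d₂ = proj₂ (proj₂ (split p pl u d₁ v d₂))

  split-covers : ∀ p F pl u d₁ v d₂ → IsChild p u → IsChild u d₁ → IsChild p v → IsChild v d₂ → u ≢ v → ∀ x → x ≢ r →
    coverParity (F ++ [ splitSet p pl u d₁ v d₂ ]) x (par x) xor (x == splitBottom p pl u d₁ v d₂)
      ≡ coverParity F x (par x) xor parity (u ∷ d₁ ∷ v ∷ d₂ ∷ []) x
  split-covers p F pl u d₁ v d₂ pu ud₁ pv vd₂ u≢v x x≢r with origin? pl v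
  ... | true  rewrite coverParity-snoc F (p ∷ u ∷ v ∷ d₂ ∷ []) x | hook-induces pu pv vd₂ u≢v x x≢r =
    xor-solve 5 (λ P U V D₂ D₁ → (P ⊕ (U ⊕ (V ⊕ (D₂ ⊕ lit false)))) ⊕ D₁ ≋ P ⊕ (U ⊕ (D₁ ⊕ (V ⊕ (D₂ ⊕ lit false))))) refl
      (coverParity F x (par x)) (x == u) (x == v) (x == d₂) (x == d₁)
  ... | false rewrite coverParity-snoc F (p ∷ v ∷ u ∷ d₁ ∷ []) x | hook-induces pv pu ud₁ (λ e → u≢v (sym e)) x x≢r =
    xor-solve 5 (λ P U V D₂ D₁ → (P ⊕ (V ⊕ (U ⊕ (D₁ ⊕ lit false)))) ⊕ D₂ ≋ P ⊕ (U ⊕ (D₁ ⊕ (V ⊕ (D₂ ⊕ lit false))))) refl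
      (coverParity F x (par x)) (x == u) (x == v) (x == d₂) (x == d₁)

  split-float : ∀ p pl u d₁ v d₂ → IsChild p u → IsChild u d₁ → IsChild p v → IsChild v d₂ →
    let a = splitTop p pl u d₁ v d₂ in IsChild p a × IsChild a (splitBottom p pl u d₁ v d₂)
  split-float p pl u d₁ v d₂ pu ud₁ pv vd₂ with origin? pl v
  ... | true  = pu , ud₁
  ... | false = pv , vd₂

  split-pairs : ∀ p pl u d₁ v d₂ → PoolOK p pl → IsChild p u → IsChild u d₁ → IsChild p v → IsChild v d₂ → u ≢ v →
    let a = splitTop p pl u d₁ v d₂ in PairCond p pl a a (splitBottom p pl u d₁ v d₂)
  split-pairs p empty           u d₁ v d₂ _ _ _ _ _ _ = tt
  split-pairs p (holding o a b) u d₁ v d₂ (po , ab , a≼o) pu ud₁ pv vd₂ u≢v with o ≟ v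
  ... | yes refl = po , pu , (λ e → u≢v (sym e)) , ab , a≼o , ud₁ , here
  ... | no o≢v   = po , pv , o≢v , ab , a≼o , vd₂ , here

  split-length : ∀ p pl u d₁ v d₂ → length (splitSet p pl u d₁ v d₂) ≡ 4
  split-length p pl u d₁ v d₂ with origin? pl v
  ... | true  = refl
  ... | false = refl

  stockPool : Stock → Pool → Fin n → Bool
  stockPool k pl x = parity (stockOpens k) x xor parity (poolOpens pl) x

  PathCond : Fin n → Stock → Pool → Fin n → Set
  PathCond p idle              pl c = ⊤
  PathCond p (leg u)           pl c = IsChild p u × u ≢ c
  PathCond p (legs u w)        pl c = IsChild p w × w ≢ c
  PathCond p (path₁ _ _)       pl c = ⊤
  PathCond p (path₂ u d₁ v d₂) pl c = IsChild p u × IsChild u d₁ × IsChild p v × IsChild v d₂ × u ≢ v × PoolOK p pl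

  addPath-covers : ∀ p F k pl c d → IsChild p c → IsChild c d → PathCond p k pl c → ∀ x → x ≢ r →
    let F′ , k′ , pl′ = addPath p F k pl c d in
    coverParity F′ x (par x) ≡ coverParity F x (par x) xor ((stockPool k pl x xor stockPool k′ pl′ x) xor ((x == c) xor (x == d)))
  addPath-covers p F idle pl c d pc cd _ x x≢r =
    xor-solve 4 (λ P I C D → P ≋ P ⊕ (((lit false ⊕ I) ⊕ ((C ⊕ (D ⊕ lit false)) ⊕ I)) ⊕ (C ⊕ D))) refl
      (coverParity F x (par x)) (parity (poolOpens pl) x) (x == c) (x == d)
  addPath-covers p F (leg u) pl c d pc cd (pu , u≢c) x x≢r
    rewrite coverParity-snoc F (p ∷ u ∷ c ∷ d ∷ []) x | hook-induces pu pc cd u≢c x x≢r =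
    xor-solve 5 (λ P I U C D → P ⊕ (U ⊕ (C ⊕ (D ⊕ lit false))) ≋ P ⊕ ((((U ⊕ lit false) ⊕ I) ⊕ (lit false ⊕ I)) ⊕ (C ⊕ D))) refl
      (coverParity F x (par x)) (parity (poolOpens pl) x) (x == u) (x == c) (x == d)
  addPath-covers p F (legs u w) pl c d pc cd (pw , w≢c) x x≢r
    rewrite coverParity-snoc F (p ∷ w ∷ c ∷ d ∷ []) x | hook-induces pw pc cd w≢c x x≢r =
    xor-solve 6 (λ P I U W C D → P ⊕ (W ⊕ (C ⊕ (D ⊕ lit false)))
                   ≋ P ⊕ ((((U ⊕ (W ⊕ lit false)) ⊕ I) ⊕ ((U ⊕ lit false) ⊕ I)) ⊕ (C ⊕ D))) refl
      (coverParity F x (par x)) (parity (poolOpens pl) x) (x == u) (x == w) (x == c) (x == d)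
  addPath-covers p F (path₁ u d₁) pl c d pc cd _ x x≢r =
    xor-solve 6 (λ P I U D₁ C D → P ≋ P ⊕ ((((U ⊕ (D₁ ⊕ lit false)) ⊕ I) ⊕ ((U ⊕ (D₁ ⊕ (C ⊕ (D ⊕ lit false)))) ⊕ I)) ⊕ (C ⊕ D))) refl
      (coverParity F x (par x)) (parity (poolOpens pl) x) (x == u) (x == d₁) (x == c) (x == d)
  addPath-covers p F (path₂ u d₁ v d₂) pl c d pc cd (pu , ud₁ , pv , vd₂ , u≢v , pool-ok) x x≢r =
    trans (addFloat-covers p (F ++ [ X ]) pl a a b (split-pairs p pl u d₁ v d₂ pool-ok pu ud₁ pv vd₂ u≢v) x x≢r)
      (trans (cong (_xor ((parity (poolOpens pl) x xor parity (poolOpens pl′) x) xor (x == b)))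
                   (xor-move {x = coverParity (F ++ [ X ]) x (par x)} {e = x == b}
                             (split-covers p F pl u d₁ v d₂ pu ud₁ pv vd₂ u≢v x x≢r)))
        (xor-solve 7 (λ P M I I′ B C D → ((P ⊕ M) ⊕ B) ⊕ ((I ⊕ I′) ⊕ B) ≋ P ⊕ (((M ⊕ I) ⊕ ((C ⊕ (D ⊕ lit false)) ⊕ I′)) ⊕ (C ⊕ D))) refl
          (coverParity F x (par x)) (parity (u ∷ d₁ ∷ v ∷ d₂ ∷ []) x) (parity (poolOpens pl) x) (parity (poolOpens pl′) x)
          (x == b) (x == c) (x == d)))
    where
    X = splitSet p pl u d₁ v d₂
    a = splitTop p pl u d₁ v d₂
    b = splitBottom p pl u d₁ v d₂
    pl′ = proj₂ (addFloat (F ++ [ X ]) pl a a b)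

  addPath-budget : ∀ p F k pl c d →
    let F′ , k′ , pl′ = addPath p F k pl c d in
    8 * length F′ + 3 * (length (stockOpens k′) + length (poolOpens pl′)) + pooled pl′
      ≤ 8 * length F + 3 * (length (stockOpens k) + length (poolOpens pl)) + pooled pl + 6
  addPath-budget p F idle pl c d = ≤-reflexive
    (ℕ-solve 3 (λ f l φ → ℕ-con 8 :* f :+ ℕ-con 3 :* (ℕ-con 2 :+ l) :+ φ := ℕ-con 8 :* f :+ ℕ-con 3 :* (ℕ-con 0 :+ l) :+ φ :+ ℕ-con 6) refl
      (length F) (length (poolOpens pl)) (pooled pl))
  addPath-budget p F (leg u) pl c d rewrite length-snoc F (p ∷ u ∷ c ∷ d ∷ []) = ≤-slack 1
    (ℕ-solve 3 (λ f l φ → ℕ-con 8 :* (f :+ ℕ-con 1) :+ ℕ-con 3 :* (ℕ-con 0 :+ l) :+ φ :+ ℕ-con 1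
                  := ℕ-con 8 :* f :+ ℕ-con 3 :* (ℕ-con 1 :+ l) :+ φ :+ ℕ-con 6) refl
      (length F) (length (poolOpens pl)) (pooled pl))
  addPath-budget p F (legs u w) pl c d rewrite length-snoc F (p ∷ w ∷ c ∷ d ∷ []) = ≤-slack 1
    (ℕ-solve 3 (λ f l φ → ℕ-con 8 :* (f :+ ℕ-con 1) :+ ℕ-con 3 :* (ℕ-con 1 :+ l) :+ φ :+ ℕ-con 1
                  := ℕ-con 8 :* f :+ ℕ-con 3 :* (ℕ-con 2 :+ l) :+ φ :+ ℕ-con 6) refl
      (length F) (length (poolOpens pl)) (pooled pl))
  addPath-budget p F (path₁ u d₁) pl c d = ≤-reflexive
    (ℕ-solve 3 (λ f l φ → ℕ-con 8 :* f :+ ℕ-con 3 :* (ℕ-con 4 :+ l) :+ φ := ℕ-con 8 :* f :+ ℕ-con 3 :* (ℕ-con 2 :+ l) :+ φ :+ ℕ-con 6) refl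
      (length F) (length (poolOpens pl)) (pooled pl))
  addPath-budget p F (path₂ u d₁ v d₂) pl c d = ≤-reflexive (begin
    8 * length F′ + 3 * (2 + length (poolOpens pl′)) + pooled pl′
      ≡⟨ ℕ-solve 3 (λ f l φ → ℕ-con 8 :* f :+ ℕ-con 3 :* (ℕ-con 2 :+ l) :+ φ := (ℕ-con 8 :* f :+ ℕ-con 3 :* l :+ φ) :+ ℕ-con 6) refl
           (length F′) (length (poolOpens pl′)) (pooled pl′) ⟩
    (8 * length F′ + 3 * length (poolOpens pl′) + pooled pl′) + 6
      ≡⟨ cong (_+ 6) (addFloat-budget (F ++ [ X ]) pl a a b) ⟩
    8 * length (F ++ [ X ]) + 3 * length (poolOpens pl) + pooled pl + 4 + 6
      ≡⟨ cong (λ m → 8 * m + 3 * length (poolOpens pl) + pooled pl + 4 + 6) (length-snoc F X) ⟩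
    8 * (length F + 1) + 3 * length (poolOpens pl) + pooled pl + 4 + 6
      ≡⟨ ℕ-solve 3 (λ f l φ → ℕ-con 8 :* (f :+ ℕ-con 1) :+ ℕ-con 3 :* l :+ φ :+ ℕ-con 4 :+ ℕ-con 6
                      := ℕ-con 8 :* f :+ ℕ-con 3 :* (ℕ-con 4 :+ l) :+ φ :+ ℕ-con 6) refl
           (length F) (length (poolOpens pl)) (pooled pl) ⟩
    8 * length F + 3 * (4 + length (poolOpens pl)) + pooled pl + 6 ∎)
    where
    open ≡-Reasoning
    X = splitSet p pl u d₁ v d₂
    a = splitTop p pl u d₁ v d₂
    b = splitBottom p pl u d₁ v d₂
    F′ = proj₁ (addFloat (F ++ [ X ]) pl a a b)
    pl′ = proj₂ (addFloat (F ++ [ X ]) pl a a b)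

  data Role : Set where
    leg-role path-role other-role : Role

  role : Out → Role
  role edge               = leg-role
  role (edge+float _ _)   = leg-role
  role (spider _ _ _ _)   = leg-role
  role (path _)           = path-role
  role (path+float _ _ _) = path-role
  role _                  = other-role

  roles-differ : ∀ (results : Fin n → Result) {u c} →
    role (out (results u)) ≡ leg-role → role (out (results c)) ≡ path-role → u ≢ c
  roles-differ results is-leg is-path refl with () ← trans (sym is-leg) is-path

  -- a float created at p itself (a ≡ o) cannot be handed up together with the edge p – par p
  Deep : Pool → Set
  Deep empty           = ⊤
  Deep (holding o a _) = a ≢ o

  StockOK : Fin n → (Fin n → Result) → Stock → Pool → Set
  StockOK p results idle              pl = Deep pl
  StockOK p results (leg u)           pl = IsChild p u × role (out (results u)) ≡ leg-role × Deep pl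
  StockOK p results (legs u w)        pl = IsChild p u × role (out (results u)) ≡ leg-role
                                         × IsChild p w × role (out (results w)) ≡ leg-role × u ≢ w × Deep pl
  StockOK p results (path₁ c d)       pl = IsChild p c × IsChild c d
  StockOK p results (path₂ u d₁ v d₂) pl = IsChild p u × IsChild u d₁ × IsChild p v × IsChild v d₂ × u ≢ v

  PathsOK : Fin n → (Fin n → Result) → List (Fin n × Fin n) → Set
  PathsOK p results = All λ (c , d) → IsChild p c × IsChild c d × role (out (results c)) ≡ path-role

  stockPaths : Stock → List (Fin n)
  stockPaths (path₁ c _)       = c ∷ []
  stockPaths (path₂ u _ v _)   = u ∷ v ∷ []
  stockPaths _                 = []

  record PathsInvariant (p : Fin n) (results : Fin n → Result) (F : List (List (Fin n))) (V : List (Fin n))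
                        (k : Stock) (pl : Pool) (cds : List (Fin n × Fin n)) : Set where
    field
      coverage    : ∀ x → x ≢ r → coverParity F x (par x) ≡ parity V x xor pending k pl cds x
      budget      : 8 * length F + 3 * #pending k pl cds + pooled pl ≤ 3 * length V
      stock-ok    : StockOK p results k pl
      pool-ok     : PoolOK p pl
      paths-ok    : PathsOK p results cds
      paths-uniq  : Unique (map proj₁ cds)
      stock-fresh : All (λ y → All (y ≢_) (map proj₁ cds)) (stockPaths k)

  addFloat-PoolOK : ∀ p F pl o a b → IsChild p o → IsChild a b → a ≼ o → PoolOK p (proj₂ (addFloat F pl o a b))
  addFloat-PoolOK p F empty           o a b po ab a≼o = po , ab , a≼o
  addFloat-PoolOK p F (holding _ _ _) o a b _  _  _   = tt

  pathCond : ∀ p results k pl c → StockOK p results k pl → PoolOK p pl → role (out (results c)) ≡ path-role → PathCond p k pl c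
  pathCond p results idle              pl c _                       _       _    = tt
  pathCond p results (leg u)           pl c (pu , is-leg , _)         _ is-path = pu , roles-differ results is-leg is-path
  pathCond p results (legs u w)        pl c (_ , _ , pw , is-leg , _) _ is-path = pw , roles-differ results is-leg is-path
  pathCond p results (path₁ _ _)       pl c _                       _       _    = tt
  pathCond p results (path₂ _ _ _ _)   pl c (pu , ud₁ , pv , vd₂ , u≢v) pool-ok _ = pu , ud₁ , pv , vd₂ , u≢v , pool-ok

  addPath-invariant : ∀ p results F V k pl c d cds → PathsInvariant p results F V k pl ((c , d) ∷ cds) →
    let F′ , k′ , pl′ = addPath p F k pl c d in PathsInvariant p results F′ V k′ pl′ cds
  addPath-invariant p results F V k pl c d cds I = record
    { coverage    = λ x x≢r → trans (addPath-covers p F k pl c d pc cd cond x x≢r)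
         (trans (cong (_xor ((stockPool k pl x xor stockPool k′ pl′ x) xor ((x == c) xor (x == d)))) (coverage x x≢r))
           (xor-solve 8 (λ V K P K′ P′ C D L → (V ⊕ ((K ⊕ P) ⊕ (C ⊕ (D ⊕ L)))) ⊕ (((K ⊕ P) ⊕ (K′ ⊕ P′)) ⊕ (C ⊕ D))
                           ≋ V ⊕ ((K′ ⊕ P′) ⊕ L)) refl
              (parity V x) (parity (stockOpens k) x) (parity (poolOpens pl) x) (parity (stockOpens k′) x) (parity (poolOpens pl′) x)
              (x == c) (x == d) (parity (pathOpens cds) x)))
    ; budget      = budget′
    ; stock-ok    = stock-ok′ k stock-ok stock-fresh
    ; pool-ok     = pool-ok′ k stock-ok pool-ok
    ; paths-ok    = All.tail paths-ok
    ; paths-uniq  = AllPairs.tail paths-uniq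
    ; stock-fresh = stock-fresh′ k stock-fresh
    }
    where
    open PathsInvariant I
    F′ = proj₁ (addPath p F k pl c d)
    k′ = proj₁ (proj₂ (addPath p F k pl c d))
    pl′ = proj₂ (proj₂ (addPath p F k pl c d))
    pc = proj₁ (All.head paths-ok)
    cd = proj₁ (proj₂ (All.head paths-ok))
    cond = pathCond p results k pl c stock-ok pool-ok (proj₂ (proj₂ (All.head paths-ok)))
    c-fresh = AllPairs.head paths-uniq

    budget′ : 8 * length F′ + 3 * #pending k′ pl′ cds + pooled pl′ ≤ 3 * length V
    budget′ = begin
      8 * length F′ + 3 * (length (stockOpens k′) + length (poolOpens pl′) + length (pathOpens cds)) + pooled pl′
        ≡⟨ ℕ-solve 5 (λ f a b l φ → ℕ-con 8 :* f :+ ℕ-con 3 :* (a :+ b :+ l) :+ φ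
                        := (ℕ-con 8 :* f :+ ℕ-con 3 :* (a :+ b) :+ φ) :+ ℕ-con 3 :* l) refl
             (length F′) (length (stockOpens k′)) (length (poolOpens pl′)) (length (pathOpens cds)) (pooled pl′) ⟩
      (8 * length F′ + 3 * (length (stockOpens k′) + length (poolOpens pl′)) + pooled pl′) + 3 * length (pathOpens cds)
        ≤⟨ +-monoˡ-≤ (3 * length (pathOpens cds)) (addPath-budget p F k pl c d) ⟩
      (8 * length F + 3 * (length (stockOpens k) + length (poolOpens pl)) + pooled pl + 6) + 3 * length (pathOpens cds)
        ≡⟨ ℕ-solve 5 (λ f a b l φ → (ℕ-con 8 :* f :+ ℕ-con 3 :* (a :+ b) :+ φ :+ ℕ-con 6) :+ ℕ-con 3 :* l
                        := ℕ-con 8 :* f :+ ℕ-con 3 :* (a :+ b :+ (ℕ-con 2 :+ l)) :+ φ) refl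
             (length F) (length (stockOpens k)) (length (poolOpens pl)) (length (pathOpens cds)) (pooled pl) ⟩
      8 * length F + 3 * #pending k pl ((c , d) ∷ cds) + pooled pl
        ≤⟨ budget ⟩
      3 * length V ∎
      where open ≤-Reasoning

    stock-ok′ : ∀ k → StockOK p results k pl → All (λ y → All (y ≢_) (map proj₁ ((c , d) ∷ cds))) (stockPaths k) →
                StockOK p results (proj₁ (proj₂ (addPath p F k pl c d))) (proj₂ (proj₂ (addPath p F k pl c d)))
    stock-ok′ idle              _                                 _                  = pc , cd
    stock-ok′ (leg u)           (_ , _ , deep)                    _                  = deep
    stock-ok′ (legs u w)        (pu , is-leg , _ , _ , _ , deep)  _                  = pu , is-leg , deep
    stock-ok′ (path₁ u d₁)      (pu , ud₁)                        ((u≢c ∷ _) ∷ [])   = pu , ud₁ , pc , cd , u≢c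
    stock-ok′ (path₂ _ _ _ _)   _                                 _                  = pc , cd

    pool-ok′ : ∀ k → StockOK p results k pl → PoolOK p pl → PoolOK p (proj₂ (proj₂ (addPath p F k pl c d)))
    pool-ok′ idle              _                          ok = ok
    pool-ok′ (leg _)           _                          ok = ok
    pool-ok′ (legs _ _)        _                          ok = ok
    pool-ok′ (path₁ _ _)       _                          ok = ok
    pool-ok′ (path₂ u d₁ v d₂) (pu , ud₁ , pv , vd₂ , _) ok =
      let pa , ab = split-float p pl u d₁ v d₂ pu ud₁ pv vd₂
      in  addFloat-PoolOK p _ pl _ _ _ pa ab here

    stock-fresh′ : ∀ k → All (λ y → All (y ≢_) (map proj₁ ((c , d) ∷ cds))) (stockPaths k) →
                   All (λ y → All (y ≢_) (map proj₁ cds)) (stockPaths (proj₁ (proj₂ (addPath p F k pl c d))))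
    stock-fresh′ idle              _                   = c-fresh ∷ []
    stock-fresh′ (leg _)           _                   = []
    stock-fresh′ (legs _ _)        _                   = []
    stock-fresh′ (path₁ _ _)       ((_ ∷ u-fresh) ∷ []) = u-fresh ∷ c-fresh ∷ []
    stock-fresh′ (path₂ _ _ _ _)   _                   = c-fresh ∷ []

  addPaths-invariant : ∀ p results F V k pl cds → PathsInvariant p results F V k pl cds →
    let F′ , k′ , pl′ = addPaths p F k pl cds in PathsInvariant p results F′ V k′ pl′ []
  addPaths-invariant p results F V k pl []              I = I
  addPaths-invariant p results F V k pl ((c , d) ∷ cds) I =
    addPaths-invariant p results _ V _ _ cds (addPath-invariant p results F V k pl c d cds I)

  LegStock : Stock → Set
  LegStock idle            = ⊤
  LegStock (leg _)         = ⊤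
  LegStock (legs _ _)      = ⊤
  LegStock (path₁ _ _)     = ⊥
  LegStock (path₂ _ _ _ _) = ⊥

  stockLegs : Stock → List (Fin n)
  stockLegs (leg u)    = u ∷ []
  stockLegs (legs u w) = u ∷ w ∷ []
  stockLegs _          = []

  poolOrigins : Pool → List (Fin n)
  poolOrigins empty           = []
  poolOrigins (holding o _ _) = o ∷ []

  Fresh : List (Fin n) → List (Fin n) → Set
  Fresh ys xs = All (λ y → All (y ≢_) xs) ys

  -- While absorbing the children of p: todo lists the children still to come, and buf (with #buf edges
  -- and flt floats) holds the open edges of the current child that are not yet placed.
  record Invariant (p : Fin n) (results : Fin n → Result) (F : List (List (Fin n))) (V : List (Fin n))
                   (k : Stock) (pl : Pool) (cds : List (Fin n × Fin n)) (todo : List (Fin n))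
                   (buf : Fin n → Bool) (#buf flt : ℕ) : Set where
    field
      coverage    : ∀ x → x ≢ r → coverParity F x (par x) ≡ (parity V x xor pending k pl cds x) xor buf x
      budget      : 8 * length F + 3 * (#pending k pl cds + #buf) + pooled pl + flt ≤ 3 * length V
      stock-ok    : StockOK p results k pl
      stock-legs  : LegStock k
      pool-ok     : PoolOK p pl
      paths-ok    : PathsOK p results cds
      paths-uniq  : Unique (map proj₁ cds)
      todo-uniq   : Unique todo
      stock-fresh : Fresh (stockLegs k) todo
      pool-fresh  : Fresh (poolOrigins pl) todo
      paths-fresh : Fresh (map proj₁ cds) todo

  AbsorbInvariant : Fin n → (Fin n → Result) → State → List (Fin n) → Set
  AbsorbInvariant p results s todo =
    Invariant p results (sets s) (verts s) (stock s) (pool s) (paths s) todo (λ _ → false) 0 0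

  absorb-child : ∀ p results s c todo R o → out R ≡ o → AbsorbInvariant p results s (c ∷ todo) → Sound c R →
    Invariant p results (sets s ++ sets R) (verts s ++ verts R) (stock s) (pool s) (paths s) todo
              (parity (opens c o)) (length (opens c o)) (floats o)
  absorb-child p results s c todo R .(out R) refl I S = record
    { coverage    = λ x x≢r → trans (coverParity-++ (sets s) (sets R) x (par x))
        (trans (cong₂ _xor_ (coverage x x≢r) (Sound.coverage S x x≢r))
          (trans (xor-solve 4 (λ A P B O → ((A ⊕ P) ⊕ lit false) ⊕ (B ⊕ O) ≋ ((A ⊕ B) ⊕ P) ⊕ O) refl
                    (parity (verts s) x) (pend x) (parity (verts R) x) (parity (opens c (out R)) x))
                 (cong (λ z → (z xor pend x) xor parity (opens c (out R)) x) (sym (parity-++ (verts s) (verts R) x)))))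
    ; budget      = budget′
    ; stock-ok    = stock-ok
    ; stock-legs  = stock-legs
    ; pool-ok     = pool-ok
    ; paths-ok    = paths-ok
    ; paths-uniq  = paths-uniq
    ; todo-uniq   = AllPairs.tail todo-uniq
    ; stock-fresh = All.map All.tail stock-fresh
    ; pool-fresh  = All.map All.tail pool-fresh
    ; paths-fresh = All.map All.tail paths-fresh
    }
    where
    open Invariant I
    pend = pending (stock s) (pool s) (paths s)

    budget′ : 8 * length (sets s ++ sets R) + 3 * (#pending (stock s) (pool s) (paths s) + length (opens c (out R)))
                + pooled (pool s) + floats (out R) ≤ 3 * length (verts s ++ verts R)
    budget′ rewrite length-++ (sets s) {sets R} | length-++ (verts s) {verts R} = begin
      8 * (length (sets s) + length (sets R)) + 3 * (#pend + length (opens c (out R))) + pooled (pool s) + floats (out R)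
        ≡⟨ ℕ-solve 6 (λ f g l o φ σ → ℕ-con 8 :* (f :+ g) :+ ℕ-con 3 :* (l :+ o) :+ φ :+ σ
                                    := (ℕ-con 8 :* f :+ ℕ-con 3 :* (l :+ ℕ-con 0) :+ φ :+ ℕ-con 0) :+ (ℕ-con 8 :* g :+ ℕ-con 3 :* o :+ σ)) refl
             (length (sets s)) (length (sets R)) #pend (length (opens c (out R))) (pooled (pool s)) (floats (out R)) ⟩
      (8 * length (sets s) + 3 * (#pend + 0) + pooled (pool s) + 0) + (8 * length (sets R) + 3 * length (opens c (out R)) + floats (out R))
        ≤⟨ +-mono-≤ budget (Sound.budget S) ⟩
      3 * length (verts s) + 3 * length (verts R)
        ≡⟨ sym (*-distribˡ-+ 3 (length (verts s)) (length (verts R))) ⟩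
      3 * (length (verts s) + length (verts R)) ∎
      where
      open ≤-Reasoning
      #pend = #pending (stock s) (pool s) (paths s)

  addFloat-Deep : ∀ F pl o a b → a ≢ o → Deep (proj₂ (addFloat F pl o a b))
  addFloat-Deep F empty           o a b a≢o = a≢o
  addFloat-Deep F (holding _ _ _) o a b _   = tt

  restock : ∀ p results k pl pl′ → LegStock k → StockOK p results k pl → Deep pl′ → StockOK p results k pl′
  restock p results idle       pl pl′ _ _                               deep = deep
  restock p results (leg u)    pl pl′ _ (pu , is-leg , _)               deep = pu , is-leg , deep
  restock p results (legs u w) pl pl′ _ (pu , lu , pw , lw , u≢w , _)   deep = pu , lu , pw , lw , u≢w , deep

  addFloat-fresh : ∀ F pl o a b todo → Fresh (poolOrigins pl) todo → All (o ≢_) todo →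
                   Fresh (poolOrigins (proj₂ (addFloat F pl o a b))) todo
  addFloat-fresh F empty           o a b todo _ o-fresh = o-fresh ∷ []
  addFloat-fresh F (holding _ _ _) o a b todo _ _       = []

  float-step : ∀ p results c F V k pl cds todo buf #buf flt a b →
    Invariant p results F V k pl cds todo buf (suc #buf) (suc flt) →
    All (_≢ c) (poolOrigins pl) → All (c ≢_) todo → IsChild p c → Float c a b →
    let F′ , pl′ = addFloat F pl c a b in
    Invariant p results F′ V k pl′ cds todo (λ x → buf x xor (x == b)) #buf flt
  float-step p results c F V k pl cds todo buf #buf flt a b I c∉pool c-fresh pc (ab , a≼c , a≢c) = record
    { coverage    = λ x x≢r → trans (addFloat-covers p F pl c a b (pair-cond pl pool-ok c∉pool) x x≢r)
        (trans (cong (_xor ((parity (poolOpens pl) x xor parity (poolOpens pl′) x) xor (x == b))) (coverage x x≢r))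
          (xor-solve 7 (λ V K P P′ D B E → ((V ⊕ ((K ⊕ P) ⊕ D)) ⊕ B) ⊕ ((P ⊕ P′) ⊕ E) ≋ (V ⊕ ((K ⊕ P′) ⊕ D)) ⊕ (B ⊕ E)) refl
            (parity V x) (parity (stockOpens k) x) (parity (poolOpens pl) x) (parity (poolOpens pl′) x)
            (parity (pathOpens cds) x) (buf x) (x == b)))
    ; budget      = budget′
    ; stock-ok    = restock p results k pl pl′ stock-legs stock-ok (addFloat-Deep F pl c a b a≢c)
    ; pool-ok     = addFloat-PoolOK p F pl c a b pc ab a≼c
    ; pool-fresh  = addFloat-fresh F pl c a b todo pool-fresh c-fresh
    ; stock-legs = stock-legs ; paths-ok = paths-ok ; paths-uniq = paths-uniq ; todo-uniq = todo-uniq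
    ; stock-fresh = stock-fresh ; paths-fresh = paths-fresh
    }
    where
    open Invariant I
    F′ = proj₁ (addFloat F pl c a b)
    pl′ = proj₂ (addFloat F pl c a b)

    pair-cond : ∀ pl → PoolOK p pl → All (_≢ c) (poolOrigins pl) → PairCond p pl c a b
    pair-cond empty              _                   _             = tt
    pair-cond (holding o′ a′ b′) (po′ , a′b′ , a′≼o′) (o′≢c ∷ []) = po′ , pc , o′≢c , a′b′ , a′≼o′ , ab , a≼c

    budget′ : 8 * length F′ + 3 * (#pending k pl′ cds + #buf) + pooled pl′ + flt ≤ 3 * length V
    budget′ = begin
      8 * length F′ + 3 * (#pending k pl′ cds + #buf) + pooled pl′ + flt
        ≡⟨ ℕ-solve 7 (λ f s q l b φ σ → ℕ-con 8 :* f :+ ℕ-con 3 :* (s :+ q :+ l :+ b) :+ φ :+ σ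
                                      := (ℕ-con 8 :* f :+ ℕ-con 3 :* q :+ φ) :+ ℕ-con 3 :* (s :+ l :+ b) :+ σ) refl
             (length F′) (length (stockOpens k)) (length (poolOpens pl′)) (length (pathOpens cds)) #buf (pooled pl′) flt ⟩
      (8 * length F′ + 3 * length (poolOpens pl′) + pooled pl′) + 3 * (length (stockOpens k) + length (pathOpens cds) + #buf) + flt
        ≡⟨ cong (λ m → m + 3 * (length (stockOpens k) + length (pathOpens cds) + #buf) + flt) (addFloat-budget F pl c a b) ⟩
      (8 * length F + 3 * length (poolOpens pl) + pooled pl + 4) + 3 * (length (stockOpens k) + length (pathOpens cds) + #buf) + flt
        ≡⟨ ℕ-solve 7 (λ f s q l b φ σ → (ℕ-con 8 :* f :+ ℕ-con 3 :* q :+ φ :+ ℕ-con 4) :+ ℕ-con 3 :* (s :+ l :+ b) :+ σ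
                                      := ℕ-con 8 :* f :+ ℕ-con 3 :* (s :+ q :+ l :+ (ℕ-con 1 :+ b)) :+ φ :+ (ℕ-con 1 :+ σ)) refl
             (length F) (length (stockOpens k)) (length (poolOpens pl)) (length (pathOpens cds)) #buf (pooled pl) flt ⟩
      8 * length F + 3 * (#pending k pl cds + suc #buf) + pooled pl + suc flt
        ≤⟨ budget ⟩
      3 * length V ∎
      where open ≤-Reasoning

  spider-step : ∀ p results c F V k pl cds todo buf #buf flt u u′ v →
    Invariant p results F V k pl cds todo buf (3 + #buf) flt → IsChild c v → IsChild c u → IsChild u u′ → v ≢ u →
    Invariant p results (F ++ [ c ∷ v ∷ u ∷ u′ ∷ [] ]) V k pl cds todo (λ x → buf x xor parity (v ∷ u ∷ u′ ∷ []) x) #buf (suc flt)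
  spider-step p results c F V k pl cds todo buf #buf flt u u′ v I cv cu uu′ v≢u = record
    { coverage    = λ x x≢r → trans (coverParity-snoc F _ x)
        (trans (cong₂ _xor_ (coverage x x≢r) (hook-induces cv cu uu′ v≢u x x≢r))
          (xor-solve 4 (λ A P B S → ((A ⊕ P) ⊕ B) ⊕ S ≋ (A ⊕ P) ⊕ (B ⊕ S)) refl
            (parity V x) (pending k pl cds x) (buf x) (parity (v ∷ u ∷ u′ ∷ []) x)))
    ; budget      = subst (_≤ 3 * length V) (sym budget-shift) budget
    ; stock-ok = stock-ok ; stock-legs = stock-legs ; pool-ok = pool-ok ; paths-ok = paths-ok
    ; paths-uniq = paths-uniq ; todo-uniq = todo-uniq ; stock-fresh = stock-fresh ; pool-fresh = pool-fresh
    ; paths-fresh = paths-fresh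
    }
    where
    open Invariant I
    budget-shift : 8 * length (F ++ [ c ∷ v ∷ u ∷ u′ ∷ [] ]) + 3 * (#pending k pl cds + #buf) + pooled pl + suc flt
                 ≡ 8 * length F + 3 * (#pending k pl cds + (3 + #buf)) + pooled pl + flt
    budget-shift rewrite length-snoc F (c ∷ v ∷ u ∷ u′ ∷ []) =
      ℕ-solve 5 (λ f l b φ σ → ℕ-con 8 :* (f :+ ℕ-con 1) :+ ℕ-con 3 :* (l :+ b) :+ φ :+ (ℕ-con 1 :+ σ)
                             := ℕ-con 8 :* f :+ ℕ-con 3 :* (l :+ (ℕ-con 3 :+ b)) :+ φ :+ σ) refl
        (length F) (#pending k pl cds) #buf (pooled pl) flt

  leg-step : ∀ p results c F V k pl cds todo buf #buf flt →
    Invariant p results F V k pl cds todo buf (suc #buf) flt → All (_≢ c) (stockLegs k) → All (c ≢_) todo →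
    IsChild p c → role (out (results c)) ≡ leg-role →
    let F′ , k′ = addLeg p F k c in
    Invariant p results F′ V k′ pl cds todo (λ x → buf x xor (x == c)) #buf flt
  leg-step p results c F V k pl cds todo buf #buf flt I c∉stock c-fresh pc is-leg = record
    { coverage    = λ x x≢r → trans (addLeg-covers p F k c (leg-cond k stock-legs stock-ok c∉stock) x x≢r)
        (trans (cong (_xor ((parity (stockOpens k) x xor parity (stockOpens k′) x) xor (x == c))) (coverage x x≢r))
          (xor-solve 7 (λ V K K′ P D B E → ((V ⊕ ((K ⊕ P) ⊕ D)) ⊕ B) ⊕ ((K ⊕ K′) ⊕ E) ≋ (V ⊕ ((K′ ⊕ P) ⊕ D)) ⊕ (B ⊕ E)) refl
            (parity V x) (parity (stockOpens k) x) (parity (stockOpens k′) x) (parity (poolOpens pl) x)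
            (parity (pathOpens cds) x) (buf x) (x == c)))
    ; budget      = budget′
    ; stock-ok    = stock-ok′ k stock-legs stock-ok c∉stock
    ; stock-legs  = stock-legs′ k stock-legs
    ; stock-fresh = stock-fresh′ k stock-legs stock-fresh
    ; pool-ok = pool-ok ; paths-ok = paths-ok ; paths-uniq = paths-uniq ; todo-uniq = todo-uniq
    ; pool-fresh = pool-fresh ; paths-fresh = paths-fresh
    }
    where
    open Invariant I
    F′ = proj₁ (addLeg p F k c)
    k′ = proj₂ (addLeg p F k c)

    leg-cond : ∀ k → LegStock k → StockOK p results k pl → All (_≢ c) (stockLegs k) → LegCond p k c
    leg-cond idle       _ _                                   _                  = tt
    leg-cond (leg _)    _ _                                   _                  = tt
    leg-cond (legs u w) _ (pu , _ , pw , _ , u≢w , _)          (u≢c ∷ w≢c ∷ [])  = pu , pw , pc , u≢w , u≢c , w≢c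

    stock-ok′ : ∀ k → LegStock k → StockOK p results k pl → All (_≢ c) (stockLegs k) →
                StockOK p results (proj₂ (addLeg p F k c)) pl
    stock-ok′ idle       _ deep                                   _          = pc , is-leg , deep
    stock-ok′ (leg u)    _ (pu , lu , deep)                       (u≢c ∷ []) = pu , lu , pc , is-leg , u≢c , deep
    stock-ok′ (legs u w) _ (_ , _ , _ , _ , _ , deep)             _          = deep

    stock-legs′ : ∀ k → LegStock k → LegStock (proj₂ (addLeg p F k c))
    stock-legs′ idle       _ = tt
    stock-legs′ (leg _)    _ = tt
    stock-legs′ (legs _ _) _ = tt

    stock-fresh′ : ∀ k → LegStock k → Fresh (stockLegs k) todo → Fresh (stockLegs (proj₂ (addLeg p F k c))) todo
    stock-fresh′ idle       _ _               = c-fresh ∷ []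
    stock-fresh′ (leg u)    _ (u-fresh ∷ [])  = u-fresh ∷ c-fresh ∷ []
    stock-fresh′ (legs _ _) _ _               = []

    budget′ : 8 * length F′ + 3 * (#pending k′ pl cds + #buf) + pooled pl + flt ≤ 3 * length V
    budget′ = begin
      8 * length F′ + 3 * (#pending k′ pl cds + #buf) + pooled pl + flt
        ≡⟨ ℕ-solve 7 (λ f s q l b φ σ → ℕ-con 8 :* f :+ ℕ-con 3 :* (s :+ q :+ l :+ b) :+ φ :+ σ
                                      := (ℕ-con 8 :* f :+ ℕ-con 3 :* s) :+ (ℕ-con 3 :* (q :+ l :+ b) :+ φ :+ σ)) refl
             (length F′) (length (stockOpens k′)) (length (poolOpens pl)) (length (pathOpens cds)) #buf (pooled pl) flt ⟩
      (8 * length F′ + 3 * length (stockOpens k′)) + (3 * (length (poolOpens pl) + length (pathOpens cds) + #buf) + pooled pl + flt)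
        ≤⟨ +-monoˡ-≤ _ (addLeg-budget p F k c (leg-cond k stock-legs stock-ok c∉stock)) ⟩
      (8 * length F + 3 * length (stockOpens k) + 3) + (3 * (length (poolOpens pl) + length (pathOpens cds) + #buf) + pooled pl + flt)
        ≡⟨ ℕ-solve 7 (λ f s q l b φ σ → (ℕ-con 8 :* f :+ ℕ-con 3 :* s :+ ℕ-con 3) :+ (ℕ-con 3 :* (q :+ l :+ b) :+ φ :+ σ)
                                      := ℕ-con 8 :* f :+ ℕ-con 3 :* (s :+ q :+ l :+ (ℕ-con 1 :+ b)) :+ φ :+ σ) refl
             (length F) (length (stockOpens k)) (length (poolOpens pl)) (length (pathOpens cds)) #buf (pooled pl) flt ⟩
      8 * length F + 3 * (#pending k pl cds + suc #buf) + pooled pl + flt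
        ≤⟨ budget ⟩
      3 * length V ∎
      where open ≤-Reasoning

  path-step : ∀ p results c d F V k pl cds todo buf #buf flt →
    Invariant p results F V k pl cds todo buf (2 + #buf) flt → All (_≢ c) (map proj₁ cds) → All (c ≢_) todo →
    IsChild p c → IsChild c d → role (out (results c)) ≡ path-role →
    Invariant p results F V k pl ((c , d) ∷ cds) todo (λ x → (buf x xor (x == c)) xor (x == d)) #buf flt
  path-step p results c d F V k pl cds todo buf #buf flt I c∉paths c-fresh pc cd is-path = record
    { coverage    = λ x x≢r → trans (coverage x x≢r)
        (xor-solve 7 (λ V K P D B C E → (V ⊕ ((K ⊕ P) ⊕ D)) ⊕ B ≋ (V ⊕ ((K ⊕ P) ⊕ (C ⊕ (E ⊕ D)))) ⊕ ((B ⊕ C) ⊕ E)) refl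
          (parity V x) (parity (stockOpens k) x) (parity (poolOpens pl) x) (parity (pathOpens cds) x) (buf x) (x == c) (x == d))
    ; budget      = subst (_≤ 3 * length V) budget-shift budget
    ; paths-ok    = (pc , cd , is-path) ∷ paths-ok
    ; paths-uniq  = All.map (λ c′≢c c≡c′ → c′≢c (sym c≡c′)) c∉paths ∷ paths-uniq
    ; paths-fresh = c-fresh ∷ paths-fresh
    ; stock-ok = stock-ok ; stock-legs = stock-legs ; pool-ok = pool-ok ; todo-uniq = todo-uniq
    ; stock-fresh = stock-fresh ; pool-fresh = pool-fresh
    }
    where
    open Invariant I
    budget-shift : 8 * length F + 3 * (#pending k pl cds + (2 + #buf)) + pooled pl + flt
                 ≡ 8 * length F + 3 * (#pending k pl ((c , d) ∷ cds) + #buf) + pooled pl + flt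
    budget-shift = ℕ-solve 7 (λ f s q l b φ σ → ℕ-con 8 :* f :+ ℕ-con 3 :* (s :+ q :+ l :+ (ℕ-con 2 :+ b)) :+ φ :+ σ
                                              := ℕ-con 8 :* f :+ ℕ-con 3 :* (s :+ q :+ (ℕ-con 2 :+ l) :+ b) :+ φ :+ σ) refl
      (length F) (length (stockOpens k)) (length (poolOpens pl)) (length (pathOpens cds)) #buf (pooled pl) flt

  settle : ∀ p results F V k pl cds todo buf → Invariant p results F V k pl cds todo buf 0 0 →
    (∀ x → x ≢ r → buf x ≡ false) → AbsorbInvariant p results (state F V k pl cds) todo
  settle p results F V k pl cds todo buf I buf≡false = record
    { coverage = λ x x≢r → trans (coverage x x≢r) (cong ((parity V x xor pending k pl cds x) xor_) (buf≡false x x≢r))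
    ; budget = budget ; stock-ok = stock-ok ; stock-legs = stock-legs ; pool-ok = pool-ok ; paths-ok = paths-ok
    ; paths-uniq = paths-uniq ; todo-uniq = todo-uniq ; stock-fresh = stock-fresh ; pool-fresh = pool-fresh
    ; paths-fresh = paths-fresh
    }
    where open Invariant I

  absorb-invariant : ∀ p results s c todo → AbsorbInvariant p results s (c ∷ todo) → IsChild p c → Sound c (results c) →
                     AbsorbInvariant p results (absorb p s c (results c)) todo
  absorb-invariant p results s c todo I pc S = absorbed
    where
    open Invariant I
    c-fresh = AllPairs.head todo-uniq
    settle′ = λ {F V k pl cds buf} → settle p results F V k pl cds todo buf
    absorb-child′ = λ o (e : out (results c) ≡ o) → absorb-child p results s c todo (results c) o e I S
    float-step′ = λ {F V k cds buf #buf flt} a b J fl →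
      float-step p results c F V k (pool s) cds todo buf #buf flt a b J (All.map All.head pool-fresh) c-fresh pc fl
    leg-step′ = λ {F V pl cds buf #buf flt} J is-leg →
      leg-step p results c F V (stock s) pl cds todo buf #buf flt J (All.map All.head stock-fresh) c-fresh pc is-leg
    path-step′ = λ {F V k pl buf #buf flt} d J cd is-path →
      path-step p results c d F V k pl (paths s) todo buf #buf flt J (All.map All.head paths-fresh) c-fresh pc cd is-path

    absorbed : AbsorbInvariant p results (absorb p s c (results c)) todo
    absorbed with out (results c) in eq
    ... | closed = settle′ (absorb-child′ closed eq) λ _ _ → refl
    ... | float a b = settle′ (float-step′ a b (absorb-child′ (float a b) eq) shape) λ x _ →
            xor-solve 1 (λ B → (B ⊕ lit false) ⊕ B ≋ lit false) refl (x == b)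
      where shape = subst (Shape c) eq (Sound.shape S)
    ... | edge = settle′ (leg-step′ (absorb-child′ edge eq) (cong role eq)) λ x _ →
            xor-solve 1 (λ C → (C ⊕ lit false) ⊕ C ≋ lit false) refl (x == c)
    ... | edge+float a b = settle′ (leg-step′ (float-step′ a b (absorb-child′ (edge+float a b) eq) (proj₁ shape)) (cong role eq)) λ x _ →
            xor-solve 2 (λ C B → ((C ⊕ (B ⊕ lit false)) ⊕ B) ⊕ C ≋ lit false) refl (x == c) (x == b)
      where shape = subst (Shape c) eq (Sound.shape S)
    ... | spider u u′ v v′ =
            let cu , uu′ , cv , vv′ , u≢v = subst (Shape c) eq (Sound.shape S)
                spider-done = spider-step p results c _ _ _ _ _ _ _ 2 0 u u′ v (absorb-child′ (spider u u′ v v′) eq)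
                                          cv cu uu′ (≢-sym u≢v)
            in  settle′ (leg-step′ (float-step′ v v′ spider-done (vv′ , child-≼ cv , dep->⇒≢ (child-< cv))) (cong role eq))
                  λ x _ → xor-solve 5 (λ C U U′ V V′ → (((C ⊕ (U ⊕ (U′ ⊕ (V ⊕ (V′ ⊕ lit false))))) ⊕ (V ⊕ (U ⊕ (U′ ⊕ lit false)))) ⊕ V′) ⊕ C
                                                     ≋ lit false) refl
                            (x == c) (x == u) (x == u′) (x == v) (x == v′)
    ... | path d = settle′ (path-step′ d (absorb-child′ (path d) eq) (subst (Shape c) eq (Sound.shape S)) (cong role eq)) λ x _ →
            xor-solve 2 (λ C D → ((C ⊕ (D ⊕ lit false)) ⊕ C) ⊕ D ≋ lit false) refl (x == c) (x == d)
    ... | path+float d a b =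
            settle′ (path-step′ d (float-step′ a b (absorb-child′ (path+float d a b) eq) (proj₂ shape))
                                (proj₁ shape) (cong role eq)) λ x _ →
              xor-solve 3 (λ C D B → (((C ⊕ (D ⊕ (B ⊕ lit false))) ⊕ B) ⊕ C) ⊕ D ≋ lit false) refl (x == c) (x == d) (x == b)
      where shape = subst (Shape c) eq (Sound.shape S)

  absorbAll-invariant : ∀ p results s todo → AbsorbInvariant p results s todo → All (IsChild p) todo →
    (∀ c → IsChild p c → Sound c (results c)) → AbsorbInvariant p results (absorbAll p results s todo) []
  absorbAll-invariant p results s []       I _           _     = I
  absorbAll-invariant p results s (c ∷ cs) I (pc ∷ pcs) sound =
    absorbAll-invariant p results (absorb p s c (results c)) cs (absorb-invariant p results s c cs I pc (sound c pc)) pcs sound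

  start-invariant : ∀ p results → AbsorbInvariant p results (state [] [] idle empty []) (children p)
  start-invariant p results = record
    { coverage = λ _ _ → refl ; budget = z≤n ; stock-ok = tt ; stock-legs = tt ; pool-ok = tt ; paths-ok = []
    ; paths-uniq = [] ; todo-uniq = children-Unique p ; stock-fresh = [] ; pool-fresh = [] ; paths-fresh = []
    }

  absorbed⇒PathsInvariant : ∀ p results s → AbsorbInvariant p results s [] →
    PathsInvariant p results (sets s) (verts s) (stock s) (pool s) (paths s)
  absorbed⇒PathsInvariant p results s I = record
    { coverage    = λ x x≢r → trans (coverage x x≢r) (xor-identityʳ _)
    ; budget      = subst (_≤ 3 * length (verts s)) (ℕ-solve 3 (λ f l φ → f :+ ℕ-con 3 :* (l :+ ℕ-con 0) :+ φ :+ ℕ-con 0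
                                                                  := f :+ ℕ-con 3 :* l :+ φ) refl
                      (8 * length (sets s)) (#pending (stock s) (pool s) (paths s)) (pooled (pool s))) budget
    ; stock-ok    = stock-ok
    ; pool-ok     = pool-ok
    ; paths-ok    = paths-ok
    ; paths-uniq  = paths-uniq
    ; stock-fresh = no-stock-paths (stock s) stock-legs
    }
    where
    open Invariant I
    no-stock-paths : ∀ k → LegStock k → All (λ y → All (y ≢_) (map proj₁ (paths s))) (stockPaths k)
    no-stock-paths idle       _ = []
    no-stock-paths (leg _)    _ = []
    no-stock-paths (legs _ _) _ = []

  absorb-verts : ∀ p s c R → verts (absorb p s c R) ≡ verts s ++ verts R
  absorb-verts p s c R with out R
  ... | closed           = refl
  ... | float _ _        = refl
  ... | edge             = refl
  ... | edge+float _ _   = refl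
  ... | spider _ _ _ _   = refl
  ... | path _           = refl
  ... | path+float _ _ _ = refl

  absorbAll-occ : ∀ p results s cs → All (IsChild p) cs → (∀ c → IsChild p c → Sound c (results c)) → ∀ x →
    occ x (verts (absorbAll p results s cs)) ≡ occ x (verts s) + sumOver (λ c → bit (below x c)) cs
  absorbAll-occ p results s []       _          _     x = sym (+-identityʳ _)
  absorbAll-occ p results s (c ∷ cs) (pc ∷ pcs) sound x = begin
    occ x (verts (absorbAll p results (absorb p s c (results c)) cs))
      ≡⟨ absorbAll-occ p results (absorb p s c (results c)) cs pcs sound x ⟩
    occ x (verts (absorb p s c (results c))) + rest
      ≡⟨ cong (λ V → occ x V + rest) (absorb-verts p s c (results c)) ⟩
    occ x (verts s ++ verts (results c)) + rest
      ≡⟨ cong (_+ rest) (trans (occ-++ x (verts s) (verts (results c))) (cong (occ x (verts s) +_) (Sound.enumerates (sound c pc) x))) ⟩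
    occ x (verts s) + bit (below x c) + rest
      ≡⟨ +-assoc (occ x (verts s)) (bit (below x c)) rest ⟩
    occ x (verts s) + sumOver (λ c → bit (below x c)) (c ∷ cs) ∎
    where
    open ≡-Reasoning
    rest = sumOver (λ c → bit (below x c)) cs

  pooled-Float : ∀ {p o a b} → PoolOK p (holding o a b) → Float p a b
  pooled-Float (po , ab , a≼o) = ab , ≼-child a≼o po , dep->⇒≢ (<-≤-trans (child-< po) (≼-dep a≼o))

  deep-pooled : ∀ {p o a b} → PoolOK p (holding o a b) → Deep (holding o a b) → par a ≢ p
  deep-pooled (po , _ , a≼o) a≢o pa≡p =
    <-irrefl (sym (cong dep pa≡p)) (<-≤-trans (child-< po) (≼-dep (≼-par a≼o λ o≡a → a≢o (sym o≡a))))

  record Finished (p : Fin n) (V : List (Fin n)) (o : Out) (F : List (List (Fin n))) : Set where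
    field
      shape    : Shape p o
      coverage : ∀ x → x ≢ r → coverParity F x (par x) ≡ parity (p ∷ V) x xor parity (opens p o) x
      budget   : 8 * length F + 3 * length (opens p o) + floats o ≤ 3 * length (p ∷ V)

  finish-sound : ∀ p results F V k pl → p ≢ r → PathsInvariant p results F V k pl [] →
    let o , F′ = finish p F k pl in Finished p V o F′
  finish-sound p results F V k pl p≢r I = go k pl stock-ok pool-ok coverage budget
    where
    open PathsInvariant I
    pp : IsChild (par p) p
    pp = refl , p≢r

    paid : ∀ {a b c d : ℕ} (G : List (List (Fin n))) (k : ℕ) → length G ≡ length F + k → 8 * length F + c + d ≤ 3 * length V →
           8 * k + a + b ≤ c + d + 3 → 8 * length G + a + b ≤ 3 * length (p ∷ V)
    paid {a} {b} {c} {d} G k G≡F+k bud ineq = begin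
      8 * length G + a + b
        ≡⟨ cong (λ m → 8 * m + a + b) G≡F+k ⟩
      8 * (length F + k) + a + b
        ≡⟨ ℕ-solve 4 (λ f k a b → ℕ-con 8 :* (f :+ k) :+ a :+ b := ℕ-con 8 :* f :+ (ℕ-con 8 :* k :+ a :+ b)) refl (length F) k a b ⟩
      8 * length F + (8 * k + a + b)
        ≤⟨ +-monoʳ-≤ (8 * length F) ineq ⟩
      8 * length F + (c + d + 3)
        ≡⟨ ℕ-solve 3 (λ f c d → f :+ (c :+ d :+ ℕ-con 3) := f :+ c :+ d :+ ℕ-con 3) refl (8 * length F) c d ⟩
      8 * length F + c + d + 3
        ≤⟨ +-monoˡ-≤ 3 bud ⟩
      3 * length V + 3
        ≡⟨ trans (+-comm (3 * length V) 3) (sym (*-suc 3 (length V))) ⟩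
      3 * length (p ∷ V) ∎
      where open ≤-Reasoning

    unchanged : length F ≡ length F + 0
    unchanged = sym (+-identityʳ (length F))

    go : ∀ k pl → StockOK p results k pl → PoolOK p pl →
         (∀ x → x ≢ r → coverParity F x (par x) ≡ parity V x xor pending k pl [] x) →
         8 * length F + 3 * #pending k pl [] + pooled pl ≤ 3 * length V →
         let o , F′ = finish p F k pl in Finished p V o F′
    go idle empty _ _ cov bud = record
      { shape    = tt
      ; coverage = λ x x≢r → trans (cov x x≢r) (xor-solve 2 (λ V P → V ⊕ ((lit false ⊕ lit false) ⊕ lit false)
                                                               ≋ (P ⊕ V) ⊕ (P ⊕ lit false)) refl (parity V x) (x == p))
      ; budget   = paid F 0 unchanged bud ≤-refl
      }
    go idle (holding o a b) deep pool-ok cov bud = record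
      { shape    = pooled-Float pool-ok , deep-pooled pool-ok deep
      ; coverage = λ x x≢r → trans (cov x x≢r) (xor-solve 3 (λ V P B → V ⊕ ((lit false ⊕ (B ⊕ lit false)) ⊕ lit false)
                                                               ≋ (P ⊕ V) ⊕ (P ⊕ (B ⊕ lit false))) refl (parity V x) (x == p) (x == b))
      ; budget   = paid F 0 unchanged bud ≤-refl
      }
    go (leg u) empty (pu , _) _ cov bud = record
      { shape    = pu
      ; coverage = λ x x≢r → trans (cov x x≢r) (xor-solve 3 (λ V P U → V ⊕ (((U ⊕ lit false) ⊕ lit false) ⊕ lit false)
                                                               ≋ (P ⊕ V) ⊕ (P ⊕ (U ⊕ lit false))) refl (parity V x) (x == p) (x == u))
      ; budget   = paid F 0 unchanged bud ≤-refl
      }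
    go (leg u) (holding o a b) (pu , _) pool-ok cov bud = record
      { shape    = pu , pooled-Float pool-ok
      ; coverage = λ x x≢r → trans (cov x x≢r) (xor-solve 4 (λ V P U B → V ⊕ (((U ⊕ lit false) ⊕ (B ⊕ lit false)) ⊕ lit false)
                                                               ≋ (P ⊕ V) ⊕ (P ⊕ (U ⊕ (B ⊕ lit false))))
                                                            refl (parity V x) (x == p) (x == u) (x == b))
      ; budget   = paid F 0 unchanged bud ≤-refl
      }
    go (legs u w) empty (pu , _ , pw , _ , u≢w , _) _ cov bud = record
      { shape    = tt
      ; coverage = λ x x≢r → trans (coverParity-snoc F _ x) (trans (cong₂ _xor_ (cov x x≢r) (upper-claw-induces pp pu pw u≢w x x≢r))
          (xor-solve 4 (λ V P U W → (V ⊕ (((U ⊕ (W ⊕ lit false)) ⊕ lit false) ⊕ lit false)) ⊕ (P ⊕ (U ⊕ (W ⊕ lit false)))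
                          ≋ (P ⊕ V) ⊕ lit false) refl (parity V x) (x == p) (x == u) (x == w)))
      ; budget   = paid (F ++ [ _ ]) 1 (length-snoc F _) bud (≤-slack 1 refl)
      }
    go (legs u w) (holding o a b) (pu , _ , pw , _ , u≢w , _) pool-ok cov bud = record
      { shape    = pooled-Float pool-ok
      ; coverage = λ x x≢r → trans (coverParity-snoc F _ x) (trans (cong₂ _xor_ (cov x x≢r) (upper-claw-induces pp pu pw u≢w x x≢r))
          (xor-solve 5 (λ V P U W B → (V ⊕ (((U ⊕ (W ⊕ lit false)) ⊕ (B ⊕ lit false)) ⊕ lit false)) ⊕ (P ⊕ (U ⊕ (W ⊕ lit false)))
                          ≋ (P ⊕ V) ⊕ (B ⊕ lit false)) refl
            (parity V x) (x == p) (x == u) (x == w) (x == b)))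
      ; budget   = paid (F ++ [ _ ]) 1 (length-snoc F _) bud (≤-slack 1 refl)
      }
    go (path₁ c d) empty (pc , cd) _ cov bud = record
      { shape    = tt
      ; coverage = λ x x≢r → trans (coverParity-snoc F _ x) (trans (cong₂ _xor_ (cov x x≢r) (path₄-induces pp pc cd x x≢r))
          (xor-solve 4 (λ V P C D → (V ⊕ (((C ⊕ (D ⊕ lit false)) ⊕ lit false) ⊕ lit false)) ⊕ (P ⊕ (C ⊕ (D ⊕ lit false)))
                          ≋ (P ⊕ V) ⊕ lit false) refl
            (parity V x) (x == p) (x == c) (x == d)))
      ; budget   = paid (F ++ [ _ ]) 1 (length-snoc F _) bud (≤-slack 1 refl)
      }
    go (path₁ c d) (holding o a b) (pc , cd) pool-ok cov bud = record
      { shape    = pooled-Float pool-ok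
      ; coverage = λ x x≢r → trans (coverParity-snoc F _ x) (trans (cong₂ _xor_ (cov x x≢r) (path₄-induces pp pc cd x x≢r))
          (xor-solve 5 (λ V P C D B → (V ⊕ (((C ⊕ (D ⊕ lit false)) ⊕ (B ⊕ lit false)) ⊕ lit false)) ⊕ (P ⊕ (C ⊕ (D ⊕ lit false)))
                          ≋ (P ⊕ V) ⊕ (B ⊕ lit false)) refl
            (parity V x) (x == p) (x == c) (x == d) (x == b)))
      ; budget   = paid (F ++ [ _ ]) 1 (length-snoc F _) bud (≤-slack 1 refl)
      }
    go (path₂ u d₁ v d₂) empty (pu , ud₁ , pv , vd₂ , u≢v) _ cov bud = record
      { shape    = pu , ud₁ , pv , vd₂ , u≢v
      ; coverage = λ x x≢r → trans (cov x x≢r)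
          (xor-solve 6 (λ V P U D₁ W D₂ → V ⊕ (((U ⊕ (D₁ ⊕ (W ⊕ (D₂ ⊕ lit false)))) ⊕ lit false) ⊕ lit false)
                          ≋ (P ⊕ V) ⊕ (P ⊕ (U ⊕ (D₁ ⊕ (W ⊕ (D₂ ⊕ lit false))))))
            refl (parity V x) (x == p) (x == u) (x == d₁) (x == v) (x == d₂))
      ; budget   = paid F 0 unchanged bud ≤-refl
      }
    go (path₂ u d₁ v d₂) pl@(holding o a b) (pu , ud₁ , pv , vd₂ , u≢v) pool-ok cov bud = record
      { shape    = tt
      ; coverage = λ x x≢r →
          trans (addFloat-covers p F₀ pl a′ a′ b′ (split-pairs p pl u d₁ v d₂ pool-ok pu ud₁ pv vd₂ u≢v) x x≢r)
            (trans (cong (_xor ((((x == b) xor false) xor false) xor (x == b′)))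
                         (xor-move {x = coverParity F₀ x (par x)} {e = x == b′}
                                   (split-covers p F pl u d₁ v d₂ pu ud₁ pv vd₂ u≢v x x≢r)))
              (trans (cong (λ y → ((y xor parity (u ∷ d₁ ∷ v ∷ d₂ ∷ []) x) xor (x == b′))
                                    xor ((((x == b) xor false) xor false) xor (x == b′))) (cov x x≢r))
                (xor-solve 5 (λ V M B B′ P → (((V ⊕ ((M ⊕ (B ⊕ lit false)) ⊕ lit false)) ⊕ M) ⊕ B′) ⊕ (((B ⊕ lit false) ⊕ lit false) ⊕ B′)
                                ≋ (P ⊕ V) ⊕ (P ⊕ lit false)) refl
                   (parity V x) (parity (u ∷ d₁ ∷ v ∷ d₂ ∷ []) x) (x == b) (x == b′) (x == p))))
      ; budget   = paid (proj₁ (addFloat F₀ pl a′ a′ b′)) 2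
                        (trans (length-snoc F₀ _) (trans (cong (_+ 1) (length-snoc F _)) (+-assoc (length F) 1 1))) bud ≤-refl
      }
      where
      F₀ = F ++ [ splitSet p pl u d₁ v d₂ ]
      a′ = splitTop p pl u d₁ v d₂
      b′ = splitBottom p pl u d₁ v d₂

  node-sound : ∀ p results → p ≢ r → (∀ c → IsChild p c → Sound c (results c)) → Sound p (node p results)
  node-sound p results p≢r sound = record
    { shape      = Finished.shape done
    ; coverage   = Finished.coverage done
    ; budget     = Finished.budget done
    ; enumerates = λ x → trans (cong (bit (x == p) +_) (absorbAll-occ p results s₀ (children p) (children-IsChild p) sound x))
                               (occ-children p x (x ≟ p) (x ≼? p))
    }
    where
    s₀ = state [] [] idle empty []
    s = absorbAll p results s₀ (children p)
    absorbed = absorbAll-invariant p results s₀ (children p) (start-invariant p results) (children-IsChild p) sound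
    paths-added = addPaths-invariant p results (sets s) (verts s) (stock s) (pool s) (paths s) (absorbed⇒PathsInvariant p results s absorbed)
    done = finish-sound p results _ (verts s) _ _ p≢r paths-added

  greedy-sound : ∀ k c → c ≢ r → n ≤ dep c + k → Sound c (greedy k c)
  greedy-sound zero    c c≢r n≤ = contradiction (≤-trans n≤ (≤-reflexive (+-identityʳ (dep c)))) (<⇒≱ (dep<n c))
  greedy-sound (suc k) c c≢r n≤ = node-sound c (greedy k) c≢r λ c′ cc′ →
    greedy-sound k c′ (proj₂ cc′) (≤-trans n≤ (≤-reflexive (trans (+-suc (dep c) k) (cong (_+ k) (sym (dep-child cc′))))))

module GreedySmall {r : Fin n} (R : Rooted n r) where
  open Rooted R
  open Children R
  open Greedy R
  open GreedySound R using (splitSet; splitTop; splitBottom; split-length)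

  Small : List (List (Fin n)) → Set
  Small = All (λ X → length X ≤ 4)

  small-snoc : ∀ {F} {X : List (Fin n)} → Small F → length X ≤ 4 → Small (F ++ [ X ])
  small-snoc F-small X-small = ++⁺ F-small (X-small ∷ [])

  addFloat-small : ∀ F pl o a b → Small F → Small (proj₁ (addFloat F pl o a b))
  addFloat-small F empty           o a b F-small = F-small
  addFloat-small F (holding _ _ _) o a b F-small = small-snoc F-small ≤-refl

  addLeg-small : ∀ p F k c → Small F → Small (proj₁ (addLeg p F k c))
  addLeg-small p F idle            c F-small = F-small
  addLeg-small p F (leg _)         c F-small = F-small
  addLeg-small p F (legs _ _)      c F-small = small-snoc F-small ≤-refl
  addLeg-small p F (path₁ _ _)     c F-small = F-small
  addLeg-small p F (path₂ _ _ _ _) c F-small = F-small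

  absorb-small : ∀ p s c R → Small (sets s) → Small (sets R) → Small (sets (absorb p s c R))
  absorb-small p s c R s-small R-small with out R
  ... | closed           = ++⁺ s-small R-small
  ... | float a b        = addFloat-small _ (pool s) c a b (++⁺ s-small R-small)
  ... | edge             = addLeg-small p _ (stock s) c (++⁺ s-small R-small)
  ... | edge+float a b   = addLeg-small p _ (stock s) c (addFloat-small _ (pool s) c a b (++⁺ s-small R-small))
  ... | spider u u′ v v′ = addLeg-small p _ (stock s) c (addFloat-small _ (pool s) c v v′ (small-snoc (++⁺ s-small R-small) ≤-refl))
  ... | path d           = ++⁺ s-small R-small
  ... | path+float d a b = addFloat-small _ (pool s) c a b (++⁺ s-small R-small)

  absorbAll-small : ∀ p results s cs → Small (sets s) → (∀ c → Small (sets (results c))) → Small (sets (absorbAll p results s cs))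
  absorbAll-small p results s []       s-small _       = s-small
  absorbAll-small p results s (c ∷ cs) s-small R-small =
    absorbAll-small p results (absorb p s c (results c)) cs (absorb-small p s c (results c) s-small (R-small c)) R-small

  split-small : ∀ p pl u d₁ v d₂ → length (splitSet p pl u d₁ v d₂) ≤ 4
  split-small p pl u d₁ v d₂ = ≤-reflexive (split-length p pl u d₁ v d₂)

  addPath-small : ∀ p F k pl c d → Small F → Small (proj₁ (addPath p F k pl c d))
  addPath-small p F idle              pl c d F-small = F-small
  addPath-small p F (leg _)           pl c d F-small = small-snoc F-small ≤-refl
  addPath-small p F (legs _ _)        pl c d F-small = small-snoc F-small ≤-refl
  addPath-small p F (path₁ _ _)       pl c d F-small = F-small
  addPath-small p F (path₂ u d₁ v d₂) pl c d F-small =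
    let a = splitTop p pl u d₁ v d₂
    in  addFloat-small (F ++ [ splitSet p pl u d₁ v d₂ ]) pl a a (splitBottom p pl u d₁ v d₂)
                       (small-snoc F-small (split-small p pl u d₁ v d₂))

  addPaths-small : ∀ p F k pl cds → Small F → Small (proj₁ (addPaths p F k pl cds))
  addPaths-small p F k pl []              F-small = F-small
  addPaths-small p F k pl ((c , d) ∷ cds) F-small =
    let F′ , k′ , pl′ = addPath p F k pl c d in addPaths-small p F′ k′ pl′ cds (addPath-small p F k pl c d F-small)

  finish-small : ∀ p F k pl → Small F → Small (proj₂ (finish p F k pl))
  finish-small p F idle              empty           F-small = F-small
  finish-small p F idle              (holding _ _ _) F-small = F-small
  finish-small p F (leg _)           empty           F-small = F-small
  finish-small p F (leg _)           (holding _ _ _) F-small = F-small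
  finish-small p F (legs _ _)        empty           F-small = small-snoc F-small ≤-refl
  finish-small p F (legs _ _)        (holding _ _ _) F-small = small-snoc F-small ≤-refl
  finish-small p F (path₁ _ _)       empty           F-small = small-snoc F-small ≤-refl
  finish-small p F (path₁ _ _)       (holding _ _ _) F-small = small-snoc F-small ≤-refl
  finish-small p F (path₂ _ _ _ _)   empty           F-small = F-small
  finish-small p F (path₂ u d₁ v d₂) pl@(holding _ _ _) F-small =
    let a = splitTop p pl u d₁ v d₂
    in  addFloat-small (F ++ [ splitSet p pl u d₁ v d₂ ]) pl a a (splitBottom p pl u d₁ v d₂)
                       (small-snoc F-small (split-small p pl u d₁ v d₂))

  greedy-small : ∀ k c → Small (sets (greedy k c))
  greedy-small zero    c = []
  greedy-small (suc k) c =
    let s = absorbAll c (greedy k) (state [] [] idle empty []) (children c)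
        F , k′ , pl = addPaths c (sets s) (stock s) (pool s) (paths s)
    in  finish-small c F k′ pl (addPaths-small c (sets s) (stock s) (pool s) (paths s)
                                  (absorbAll-small c (greedy k) (state [] [] idle empty []) (children c) [] (greedy-small k)))

-- The root r is a leaf whose only child is p₀: the edge r – p₀ closes what the greedy leaves open at p₀.
module ClosedAtLeaf {r : Fin n} (R : Rooted n r) (p₀ : Fin n) (rp₀ : RootedTheory.IsChild R r p₀)
                    (only-child : ∀ c → RootedTheory.IsChild R r c → c ≡ p₀) where
  open Rooted R
  open RootedTheory R
  open InducedEdges R
  open Children R
  open Greedy R
  open GreedySound R
  open GreedySmall R

  closing : Out → List (List (Fin n))
  closing closed             = []
  closing (float a b)        = (a ∷ b ∷ []) ∷ []
  closing edge               = (r ∷ p₀ ∷ []) ∷ []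
  closing (edge+float a b)   = (r ∷ p₀ ∷ a ∷ b ∷ []) ∷ []
  closing (spider u u′ v v′) = (r ∷ p₀ ∷ u ∷ u′ ∷ []) ∷ (p₀ ∷ v ∷ v′ ∷ []) ∷ []
  closing (path d)           = (r ∷ p₀ ∷ d ∷ []) ∷ []
  closing (path+float d a b) = (r ∷ p₀ ∷ d ∷ []) ∷ (a ∷ b ∷ []) ∷ []

  ≼p₀⇒≢r : ∀ {x} → x ≼ p₀ → x ≢ r
  ≼p₀⇒≢r {x} x≼p₀ = dep-pos⇒≢r (subst (_< dep x) dep-r (<-≤-trans (child-< rp₀) (≼-dep x≼p₀)))

  root-float-induces : ∀ {a b} → Float p₀ a b → par a ≢ p₀ → Induces (r ∷ p₀ ∷ a ∷ b ∷ []) (p₀ ∷ b ∷ [])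
  root-float-induces (ab , a≼p₀ , a≢p₀) pa≢p₀ =
    two-edges-induce rp₀ ab
      ((≢-sym (≼p₀⇒≢r a≼p₀) ∷ ≢-sym (proj₂ ab) ∷ [])
        ∷ (≢-sym a≢p₀ ∷ dep-<⇒≢ (≤-<-trans (≼-dep a≼p₀) (child-< ab)) ∷ []) ∷ [])
      (λ r≢r → contradiction refl r≢r)
      (λ _ → ≼p₀⇒≢r (≼-par a≼p₀ (≢-sym a≢p₀)) ∷ pa≢p₀ ∷ [])

  closing-covers : ∀ o → Shape p₀ o → ∀ x → x ≢ r → coverParity (closing o) x (par x) ≡ parity (opens p₀ o) x
  closing-covers closed             _ x x≢r = refl
  closing-covers (float a b)        (ab , _) x x≢r = trans (xor-identityʳ _) (edge-induces ab x x≢r)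
  closing-covers edge               _ x x≢r = trans (xor-identityʳ _) (edge-induces rp₀ x x≢r)
  closing-covers (edge+float a b)   (fl , pa≢p₀) x x≢r = trans (xor-identityʳ _) (root-float-induces fl pa≢p₀ x x≢r)
  closing-covers (spider u u′ v v′) (p₀u , uu′ , p₀v , vv′ , _) x x≢r
    rewrite path₄-induces rp₀ p₀u uu′ x x≢r | path₃-induces p₀v vv′ x x≢r =
    xor-solve 5 (λ P U U′ V V′ → (P ⊕ (U ⊕ (U′ ⊕ lit false))) ⊕ ((V ⊕ (V′ ⊕ lit false)) ⊕ lit false)
                   ≋ P ⊕ (U ⊕ (U′ ⊕ (V ⊕ (V′ ⊕ lit false)))))
      refl (x == p₀) (x == u) (x == u′) (x == v) (x == v′)
  closing-covers (path d)           p₀d x x≢r = trans (xor-identityʳ _) (path₃-induces rp₀ p₀d x x≢r)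
  closing-covers (path+float d a b) (p₀d , ab , _) x x≢r
    rewrite path₃-induces rp₀ p₀d x x≢r | edge-induces ab x x≢r =
    xor-solve 3 (λ P D B → (P ⊕ (D ⊕ lit false)) ⊕ ((B ⊕ lit false) ⊕ lit false)
                   ≋ P ⊕ (D ⊕ (B ⊕ lit false))) refl (x == p₀) (x == d) (x == b)

  closing-budget : ∀ o → 8 * length (closing o) ≤ 3 * length (opens p₀ o) + floats o + 7
  closing-budget closed             = z≤n
  closing-budget (float _ _)        = ≤-slack 3 refl
  closing-budget edge               = ≤-slack 2 refl
  closing-budget (edge+float _ _)   = ≤-slack 6 refl
  closing-budget (spider _ _ _ _)   = ≤-slack 6 refl
  closing-budget (path _)           = ≤-slack 5 refl
  closing-budget (path+float _ _ _) = ≤-slack 1 refl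

  closing-small : ∀ o → Small (closing o)
  closing-small closed             = []
  closing-small (float _ _)        = ≤-slack 2 refl ∷ []
  closing-small edge               = ≤-slack 2 refl ∷ []
  closing-small (edge+float _ _)   = ≤-refl ∷ []
  closing-small (spider _ _ _ _)   = ≤-refl ∷ ≤-slack 1 refl ∷ []
  closing-small (path _)           = ≤-slack 1 refl ∷ []
  closing-small (path+float _ _ _) = ≤-slack 1 refl ∷ ≤-slack 2 refl ∷ []

  result₀ : Result
  result₀ = greedy n p₀

  sound₀ : Sound p₀ result₀
  sound₀ = greedy-sound n p₀ (proj₂ rp₀) (m≤n+m n (dep p₀))

  family : List (List (Fin n))
  family = sets result₀ ++ closing (out result₀)

  below-p₀ : ∀ x → x ≢ r → below x p₀ ≡ true
  below-p₀ x x≢r with ≼-child-of (≼-root x) x≢r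
  ... | c , rc , x≼c = dec-true (x ≼? p₀) (subst (x ≼_) (only-child c rc) x≼c)

  family-covers : ∀ x → x ≢ r → coverParity family x (par x) ≡ true
  family-covers x x≢r = begin
    coverParity family x (par x)
      ≡⟨ coverParity-++ (sets result₀) (closing (out result₀)) x (par x) ⟩
    coverParity (sets result₀) x (par x) xor coverParity (closing (out result₀)) x (par x)
      ≡⟨ cong₂ _xor_ (Sound.coverage sound₀ x x≢r) (closing-covers (out result₀) (Sound.shape sound₀) x x≢r) ⟩
    (parity (verts result₀) x xor parity (opens p₀ (out result₀)) x) xor parity (opens p₀ (out result₀)) x
      ≡⟨ xor-solve 2 (λ V O → (V ⊕ O) ⊕ O ≋ V) refl (parity (verts result₀) x) (parity (opens p₀ (out result₀)) x) ⟩
    parity (verts result₀) x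
      ≡⟨ parity-occ (verts result₀) x ⟩
    odd (occ x (verts result₀))
      ≡⟨ cong odd (trans (Sound.enumerates sound₀ x) (cong bit (below-p₀ x x≢r))) ⟩
    true ∎
    where open ≡-Reasoning

  verts-short : length (verts result₀) + 1 ≤ n
  verts-short = begin
    length (verts result₀) + 1
      ≡⟨ cong₂ _+_ (length-occ (verts result₀)) (sym (sumOver-== (allFin n) (allFin⁺ n) (∈-allFin r))) ⟩
    sumOver (λ x → occ x (verts result₀)) (allFin n) + sumOver (λ x → bit (x == r)) (allFin n)
      ≡⟨ sym (sumOver-+ _ _ (allFin n)) ⟩
    sumOver (λ x → occ x (verts result₀) + bit (x == r)) (allFin n)
      ≤⟨ sumOver-mono _ (λ _ → 1) (allFin n) at-most-once ⟩
    sumOver (λ _ → 1) (allFin n)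
      ≡⟨ trans (sumOver-1 (allFin n)) (length-tabulate id) ⟩
    n ∎
    where
    open ≤-Reasoning
    at-most-once : ∀ x → occ x (verts result₀) + bit (x == r) ≤ 1
    at-most-once x rewrite Sound.enumerates sound₀ x with x ≟ r
    ... | yes refl rewrite dec-false (r ≼? p₀) (λ r≼p₀ → ≼p₀⇒≢r r≼p₀ refl) = ≤-refl
    ... | no x≢r rewrite below-p₀ x x≢r = ≤-refl

  family-size : 8 * length family ≤ 3 * (n ∸ 1) + 7
  family-size = begin
    8 * length family
      ≡⟨ cong (8 *_) (length-++ (sets result₀)) ⟩
    8 * (length (sets result₀) + length (closing (out result₀)))
      ≡⟨ *-distribˡ-+ 8 (length (sets result₀)) _ ⟩
    8 * length (sets result₀) + 8 * length (closing (out result₀))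
      ≤⟨ +-monoʳ-≤ (8 * length (sets result₀)) (closing-budget (out result₀)) ⟩
    8 * length (sets result₀) + (3 * length (opens p₀ (out result₀)) + floats (out result₀) + 7)
      ≡⟨ ℕ-solve 4 (λ a b c d → a :+ (ℕ-con 3 :* b :+ c :+ d) := (a :+ ℕ-con 3 :* b :+ c) :+ d) refl
           (8 * length (sets result₀)) (length (opens p₀ (out result₀))) (floats (out result₀)) 7 ⟩
    (8 * length (sets result₀) + 3 * length (opens p₀ (out result₀)) + floats (out result₀)) + 7
      ≤⟨ +-monoˡ-≤ 7 (Sound.budget sound₀) ⟩
    3 * length (verts result₀) + 7
      ≤⟨ +-monoˡ-≤ 7 (*-monoʳ-≤ 3 (subst (_≤ n ∸ 1) (m+n∸n≡m (length (verts result₀)) 1) (∸-monoˡ-≤ 1 verts-short))) ⟩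
    3 * (n ∸ 1) + 7 ∎
    where open ≤-Reasoning

  family-small : Small family
  family-small = ++⁺ (greedy-small n p₀) (closing-small (out result₀))

module DeepestLeaf (T : Graph n) (acyclic : ¬ HasCycle T) {r₀ : Fin n} (R₀ : Rooted n r₀) (parent-adj₀ : ParentEdges T R₀)
                   (x : Fin n) (deepest : ∀ y → Rooted.dep R₀ y ≤ Rooted.dep R₀ x) (x≢r₀ : x ≢ r₀) where
  open Rooted R₀
  open Acyclic T R₀ parent-adj₀ using (edge⇒parent-edge; adj⇒≢)

  neighbour-is-parent : ∀ c → adj T x c ≡ true → c ≡ par x
  neighbour-is-parent c xc with edge⇒parent-edge acyclic x c xc
  ... | inj₁ px≡c = sym px≡c
  ... | inj₂ pc≡x = contradiction (deepest c) (<⇒≱ (subst (λ z → suc (dep z) ≤ dep c) pc≡x (≤-reflexive (dep-par c c≢r₀))))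
    where
    c≢r₀ : c ≢ r₀
    c≢r₀ c≡r₀ = x≢r₀ (trans (sym pc≡x) (trans (cong par c≡r₀) par-r))

  module Rerooted (R : Rooted n x) (parent-adj : ParentEdges T R) where
    open Acyclic T R parent-adj using () renaming (edge⇒parent-edge to edge⇒parent-edge′)

    root-child : RootedTheory.IsChild R x (par x)
    root-child with edge⇒parent-edge′ acyclic x (par x) (parent-adj₀ x x≢r₀)
    ... | inj₁ px≡p₀ = contradiction (trans (sym (Rooted.par-r R)) px≡p₀) (adj⇒≢ (parent-adj₀ x x≢r₀))
    ... | inj₂ pp₀≡x = pp₀≡x , λ p₀≡x → adj⇒≢ (parent-adj₀ x x≢r₀) (sym p₀≡x)

    only-child : ∀ c → RootedTheory.IsChild R x c → c ≡ par x
    only-child c (pc≡x , c≢x) = neighbour-is-parent c x-adj-c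
      where
      c-adj-x : adj T c x ≡ true
      c-adj-x = subst (λ z → adj T c z ≡ true) pc≡x (parent-adj c c≢x)
      x-adj-c : adj T x c ≡ true
      x-adj-c = trans (Graph.sym T x c) c-adj-x

deepest-vertex : (f : Fin (suc n) → ℕ) → Σ (Fin (suc n)) λ x → ∀ y → f y ≤ f x
deepest-vertex {n} f = argmax f zero (allFin (suc n)) , λ y →
  v≤f[argmax]⁺ zero (allFin (suc n)) (inj₂ (Any.map (λ y≡z → ≤-reflexive (cong f y≡z)) (∈-allFin y)))

deepest≢root : (R : Rooted (2 + n) zero) (x : Fin (2 + n)) → (∀ y → Rooted.dep R y ≤ Rooted.dep R x) → x ≢ zero
deepest≢root R x deepest refl
  with () ← RootedTheory.dep≡0⇒root R (suc zero) (n≤0⇒n≡0 (subst (Rooted.dep R (suc zero) ≤_) (Rooted.dep-r R) (deepest (suc zero))))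

≤-/8 : ∀ k m → 8 * k ≤ m → k ≤ m / 8
≤-/8 k m 8k≤m = subst (_≤ m / 8) (m*n/n≡m k 8) (/-monoˡ-≤ 8 (subst (_≤ m) (*-comm 8 k) 8k≤m))

conv-from-leaf-root : (T : Graph n) → ¬ HasCycle T → ∀ {r} (R : Rooted n r) → ParentEdges T R →
  ∀ p₀ → RootedTheory.IsChild R r p₀ → (∀ c → RootedTheory.IsChild R r c → c ≡ p₀) →
  ConvAtMost 4 T ((3 * (n ∸ 1) + 7) / 8)
conv-from-leaf-root {n} T acyclic R parent-adj p₀ rp₀ only-child D =
  map toSubset family ,
  subst (_≤ (3 * (n ∸ 1) + 7) / 8) (sym (length-map toSubset family)) (≤-/8 (length family) _ family-size) ,
  All.map⁺ (All.map (λ {X} X≤4 → ≤-trans (∣toSubset∣≤length X) X≤4) family-small) ,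
  invertAll-converse D family (Acyclic.edges-covered T R parent-adj acyclic family family-covers)
  where open ClosedAtLeaf R p₀ rp₀ only-child

theorem22 : (n : ℕ) (T : Graph n) → 1 ≤ n → IsTree T →
    ConvAtMost 4 T ((3 * (n ∸ 1) + 7) / 8)
theorem22 (suc zero)    T _ _ D = [] , z≤n , [] , λ { zero zero → refl }
theorem22 (suc (suc m)) T _ (connected , acyclic) with spanningTree T connected zero
... | R₀ , parent-adj₀ with deepest-vertex (Rooted.dep R₀)
...   | x , deepest with spanningTree T connected x
...     | R , parent-adj =
  conv-from-leaf-root T acyclic R parent-adj (Rooted.par R₀ x) root-child only-child
  where
  open DeepestLeaf T acyclic R₀ parent-adj₀ x deepest (deepest≢root R₀ x deepest)
  open Rerooted R parent-adj
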